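{- Let $q$ be a prime power, $m,n$ positive integers, and let $\alpha\in\mathbb{F}_{q^{mn}}$ be such that $\mathbb{F}_{q^{mn}}=\mathbb{F}_q(\alpha)$. Suppose $\beta\in\mathbb{F}_{q^{mn}}$ satisfies $$\beta=\frac{a\alpha^{q^r}+b}{c\alpha^{q^r}+d}$$ for some nonnegative integer $r$ and some matrix $\begin{pmatrix}a&b\\c&d\end{pmatrix}\in\mathrm{GL}_2(\mathbb{F}_q)$. Then $\mathbb{F}_{q^{mn}}=\mathbb{F}_q(\beta)$ and $S(\alpha,m,n;q)=S(\beta,m,n;q)$.
   Context: $\mathbb{F}_q$ denotes the finite field with $q$ elements. For $\gamma\in\mathbb{F}_{q^{mn}}$, an $m$-dimensional $\mathbb{F}_q$-linear subspace $W$ of $\mathbb{F}_{q^{mn}}$ is called $\gamma$-splitting if $\mathbb{F}_{q^{mn}}=W\oplus \gamma W\oplus\cdots\oplus\gamma^{n-1}W$ (internal direct sum of $\mathbb{F}_q$-subspaces), and $S(\gamma,m,n;q)$ denotes the number of $m$-dimensional $\gamma$-splitting subspaces of $\mathbb{F}_{q^{mn}}$. -}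

module Defs where

open import Data.Nat using (ℕ; zero; suc; _≤_; _^_)
open import Data.Nat.Primality using (Prime)
open import Data.Fin using (Fin; zero; suc)
open import Data.Fin.Subset using (Subset; _∈_)
open import Data.Product using (Σ; ∃; ∃-syntax; _×_; _,_)
open import Relation.Binary.PropositionalEquality using (_≡_; _≢_)
open import Algebra.Structures using (IsCommutativeRing)
open import Function.Definitions using (Injective)

IsPrimePower : ℕ → Set
IsPrimePower q = ∃[ p ] ∃[ k ] (Prime p × 1 ≤ k × q ≡ p ^ k)

-- A finite field whose underlying set is Fin N (so it has exactly N elements),
-- with propositional equality as the equality.
record FiniteField (N : ℕ) : Set where
  infixl 6 _+_
  infixl 7 _*_
  field
    _+_ _*_    : Fin N → Fin N → Fin N
    -_         : Fin N → Fin N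
    0# 1#      : Fin N
    isCommutativeRing : IsCommutativeRing _≡_ _+_ _*_ -_ 0# 1#
    0≢1        : 0# ≢ 1#
    inverse    : ∀ x → x ≢ 0# → ∃[ y ] (x * y ≡ 1#)

  _-_ : Fin N → Fin N → Fin N
  x - y = x + (- y)

  pow : Fin N → ℕ → Fin N
  pow x zero    = 1#
  pow x (suc k) = x * pow x k

  sumF : ∀ {k} → (Fin k → Fin N) → Fin N
  sumF {zero}  f = 0#
  sumF {suc k} f = f zero + sumF (λ i → f (suc i))

-- Definitions relative to a finite field F and a prime power q
-- (F is meant to be F_{q^{mn}}).
module FieldDefs {N : ℕ} (F : FiniteField N) (q : ℕ) where
  open FiniteField F

  -- the subfield F_q of F: elements with x^q = x
  InFq : Fin N → Set
  InFq x = pow x q ≡ x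

  IsSubfield : Subset N → Set
  IsSubfield K =
      0# ∈ K × 1# ∈ K
    × (∀ x y → x ∈ K → y ∈ K → x + y ∈ K)
    × (∀ x → x ∈ K → - x ∈ K)
    × (∀ x y → x ∈ K → y ∈ K → x * y ∈ K)
    × (∀ x y → x ∈ K → x * y ≡ 1# → y ∈ K)

  -- F = F_q(α): the only subfield containing F_q and α is F itself
  Generates : Fin N → Set
  Generates α = ∀ K → IsSubfield K → (∀ x → InFq x → x ∈ K) → α ∈ K → ∀ x → x ∈ K

  IsSubspace : Subset N → Set
  IsSubspace W =
      0# ∈ W
    × (∀ x y → x ∈ W → y ∈ W → x + y ∈ W)
    × (∀ c x → InFq c → x ∈ W → c * x ∈ W)

  HasDim : ℕ → Subset N → Set
  HasDim m W = Σ (Fin m → Fin N) λ e →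
      (∀ i → e i ∈ W)
    × (∀ (c : Fin m → Fin N) → (∀ i → InFq (c i)) →
         sumF (λ i → c i * e i) ≡ 0# → ∀ i → c i ≡ 0#)
    × (∀ x → x ∈ W → Σ (Fin m → Fin N) λ c →
         (∀ i → InFq (c i)) × sumF (λ i → c i * e i) ≡ x)

  -- F = W ⊕ γW ⊕ ... ⊕ γ^{n-1}W (internal direct sum): every x is uniquely
  -- a sum Σ_{i<n} u_i with u_i ∈ γ^i W
  InScaled : Fin N → ℕ → Subset N → Fin N → Set
  InScaled γ i W u = ∃[ w ] (w ∈ W × u ≡ pow γ i * w)

  IsDirectSumDecomp : ℕ → Fin N → Subset N → Set
  IsDirectSumDecomp n γ W =
      (∀ x → Σ (Fin n → Fin N) λ u →
          (∀ i → InScaled γ (Data.Fin.toℕ i) W (u i)) × sumF u ≡ x)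
    × (∀ (u v : Fin n → Fin N) →
          (∀ i → InScaled γ (Data.Fin.toℕ i) W (u i)) →
          (∀ i → InScaled γ (Data.Fin.toℕ i) W (v i)) →
          sumF u ≡ sumF v → ∀ i → u i ≡ v i)

  IsSplitting : ℕ → ℕ → Fin N → Subset N → Set
  IsSplitting m n γ W = IsSubspace W × HasDim m W × IsDirectSumDecomp n γ W

-- The number of subsets of Fin N satisfying P is k:
-- an injective enumeration Fin k → Subset N whose image is exactly {W | P W}.
HasCount : ∀ {N} → (Subset N → Set) → ℕ → Set
HasCount {N} P k = Σ (Fin k → Subset N) λ f →
    Injective _≡_ _≡_ f
  × (∀ W → P W → ∃[ i ] (f i ≡ W))
  × (∀ i → P (f i))

module _ {N : ℕ} (F : FiniteField N) (q : ℕ) where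
  open FieldDefs F q
  SplittingCount : ℕ → ℕ → Fin N → ℕ → Set
  SplittingCount m n γ k = HasCount (IsSplitting m n γ) k

open FieldDefs public

module Submission where

-- The Frobenius map x ↦ x ^ (q ^ r) is a field automorphism fixing 𝔽_q, so it preserves generators and
-- splitting subspaces; this reduces the claim to γ = α ^ (q ^ r). A Möbius map with coefficients in 𝔽_q
-- is a composite of affine maps x ↦ A x + B (A ∈ 𝔽_q^*, B ∈ 𝔽_q) and one inversion x ↦ x⁻¹, and each
-- of these preserves S(-,m,n;q): scaling by A leaves every γⁱW unchanged; translating by B rewrites
-- Σ (γ + B)ⁱ wᵢ as Σ γⁱ tᵢ with (tᵢ) a unitriangular transform of (wᵢ), so the same W splits (this needs
-- γ ≠ 0); and inversion sends a γ-splitting W to the γ⁻¹-splitting γⁿ⁻¹W with the summands reversed.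
-- For n ≥ 2, γ ∉ 𝔽_q, as otherwise all q ^ (m n) > q field elements would be roots of xᵠ - x, so every
-- intermediate element stays outside 𝔽_q and is nonzero. For n = 1 the splitting condition does not
-- involve γ. Finally γ is itself a Möbius image of β, whence 𝔽_q(β) contains γ and hence all of F.

open import Data.Nat as ℕ using (ℕ; zero; suc; _∸_; _<_; _≤_; z≤n; s≤s; pred)
import Data.Nat.Properties as ℕ
open import Data.Nat.Combinatorics using (_C_; nCn≡1; nCk+nC[k+1]≡[n+1]C[k+1])
open import Data.Nat.Divisibility using (_∣_; divides; m∣m*n; ∣⇒≤)
open import Data.Nat.Primality using (Prime; euclidsLemma; prime⇒nonZero; prime⇒nonTrivial)
open import Data.Nat.Solver using (module +-*-Solver)
open import Data.Fin as Fin using (Fin; zero; suc; toℕ; inject₁; inject≤; fromℕ; punchOut)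
import Data.Fin.Properties as Fin
open import Data.Fin.Permutation as Perm using (Permutation; permutation; _⟨$⟩ʳ_; _⟨$⟩ˡ_; inverseʳ; inverseˡ)
open import Data.Fin.Subset using (Subset; _∈_)
open import Data.Vec using (tabulate; lookup)
open import Data.Vec.Properties using (lookup∘tabulate; tabulate-cong; tabulate∘lookup; lookup⇒[]=; []=⇒lookup)
open import Data.List using (List; []; _∷_; length)
open import Data.List.Relation.Unary.All using (All; []; _∷_)
open import Data.Product using (Σ; ∃; _×_; _,_; proj₁; proj₂)
open import Data.Sum using (_⊎_; inj₁; inj₂; [_,_]′)
open import Data.Empty using (⊥-elim)
open import Relation.Nullary using (¬_; Dec; yes; no; does)
open import Relation.Binary.PropositionalEquality
open import Function.Base using (id; _∘_)
open import Function.Definitions using (Injective)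
open import Algebra.Bundles using (CommutativeRing)
import Algebra.Solver.Ring.NaturalCoefficients.Default as NaturalSolver
open import Defs using (FiniteField; module FieldDefs; HasCount; SplittingCount; IsPrimePower)

-- Binomial coefficients by Pascal's rule, which unlike n C k compute on open terms.
pascal : ℕ → ℕ → ℕ
pascal n       zero    = 1
pascal zero    (suc k) = 0
pascal (suc n) (suc k) = pascal n k ℕ.+ pascal n (suc k)

pascal≡C : ∀ n k → pascal n k ≡ n C k
pascal≡C n       zero    = refl
pascal≡C zero    (suc k) = refl
pascal≡C (suc n) (suc k) =
  trans (cong₂ ℕ._+_ (pascal≡C n k) (pascal≡C n (suc k))) (nCk+nC[k+1]≡[n+1]C[k+1] n k)

pascal-absorb : ∀ n k → suc k ℕ.* pascal (suc n) (suc k) ≡ suc n ℕ.* pascal n k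
pascal-absorb zero    zero    = refl
pascal-absorb zero    (suc k) = ℕ.*-zeroʳ (suc (suc k))
pascal-absorb (suc n) zero    = cong suc (trans (ℕ.+-identityʳ _) (trans (pascal-n-1 (suc n)) (sym (ℕ.*-identityʳ _))))
  where
  pascal-n-1 : ∀ n → pascal n 1 ≡ n
  pascal-n-1 zero    = refl
  pascal-n-1 (suc n) = cong suc (pascal-n-1 n)
pascal-absorb (suc n) (suc k) = begin
  suc (suc k) ℕ.* (X ℕ.+ Y)
    ≡⟨ solve 3 (λ k X Y → (con 2 :+ k) :* (X :+ Y) := X :+ (con 1 :+ k) :* X :+ (con 2 :+ k) :* Y) refl k X Y ⟩
  X ℕ.+ suc k ℕ.* X ℕ.+ suc (suc k) ℕ.* Y
    ≡⟨ cong₂ (λ u v → X ℕ.+ u ℕ.+ v) (pascal-absorb n k) (pascal-absorb n (suc k)) ⟩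
  X ℕ.+ suc n ℕ.* pascal n k ℕ.+ suc n ℕ.* pascal n (suc k)
    ≡⟨ solve 4 (λ n X u v → X :+ (con 1 :+ n) :* u :+ (con 1 :+ n) :* v := X :+ (con 1 :+ n) :* (u :+ v)) refl n X (pascal n k) (pascal n (suc k)) ⟩
  X ℕ.+ suc n ℕ.* X ∎
  where
  open ≡-Reasoning
  open +-*-Solver
  X = pascal (suc n) (suc k)
  Y = pascal (suc n) (suc (suc k))

-- From k · C(p,k) = p · C(p-1,k-1) and Euclid's lemma, since p cannot divide 0 < k < p.
prime∣pCk : ∀ {p k} → Prime p → 0 < k → k < p → p ∣ p C k
prime∣pCk {suc p} {suc k} p-prime _ k<p =
  subst (suc p ∣_) (pascal≡C (suc p) (suc k)) ([ ⊥-elim ∘ p∤k , id ]′ (euclidsLemma _ _ p-prime p∣k*pCk))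
  where
  p∣k*pCk : suc p ∣ suc k ℕ.* pascal (suc p) (suc k)
  p∣k*pCk = subst (suc p ∣_) (sym (pascal-absorb p k)) (m∣m*n (pascal p k))
  p∤k : ¬ suc p ∣ suc k
  p∤k p∣k = ℕ.<⇒≱ k<p (∣⇒≤ p∣k)

-- A missed value would let f inject Fin (suc n) into Fin n.
injective⇒surjective : ∀ {n} (f : Fin n → Fin n) → Injective _≡_ _≡_ f → ∀ y → ∃ λ x → f x ≡ y
injective⇒surjective {zero}  f f-inj ()
injective⇒surjective {suc n} f f-inj y with Fin.any? (λ x → f x Fin.≟ y)
... | yes hit  = hit
... | no  miss = ⊥-elim (ℕ.<-irrefl refl (Fin.injective⇒≤ g-inj))
  where
  g : Fin (suc n) → Fin n
  g x = punchOut {i = y} (λ e → miss (x , sym e))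
  g-inj : Injective _≡_ _≡_ g
  g-inj {a} {b} = f-inj ∘ Fin.punchOut-injective (λ e → miss (a , sym e)) (λ e → miss (b , sym e))

preimage : ∀ {n} → (Fin n → Fin n) → Subset n → Subset n
preimage f W = tabulate (λ y → lookup W (f y))

∈-preimage⁺ : ∀ {n} f (W : Subset n) {y} → f y ∈ W → y ∈ preimage f W
∈-preimage⁺ f W {y} fy∈W = lookup⇒[]= y (preimage f W) (trans (lookup∘tabulate _ y) ([]=⇒lookup fy∈W))

∈-preimage⁻ : ∀ {n} f (W : Subset n) {y} → y ∈ preimage f W → f y ∈ W
∈-preimage⁻ f W {y} y∈ = lookup⇒[]= (f y) W (trans (sym (lookup∘tabulate _ y)) ([]=⇒lookup y∈))

preimage-inverse : ∀ {n} (f g : Fin n → Fin n) → (∀ x → g (f x) ≡ x) → ∀ W → preimage f (preimage g W) ≡ W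
preimage-inverse f g g∘f W =
  trans (tabulate-cong (λ y → trans (lookup∘tabulate _ (f y)) (cong (lookup W) (g∘f y)))) (tabulate∘lookup W)

decSubset : ∀ {n} {P : Fin n → Set} → (∀ x → Dec (P x)) → Subset n
decSubset P? = tabulate (λ x → does (P? x))

∈-decSubset⁺ : ∀ {n} {P : Fin n → Set} (P? : ∀ x → Dec (P x)) {x} → P x → x ∈ decSubset P?
∈-decSubset⁺ P? {x} px with P? x in eq
... | yes _  = lookup⇒[]= x (decSubset P?) (trans (lookup∘tabulate _ x) (cong does eq))
... | no ¬px = ⊥-elim (¬px px)

∈-decSubset⁻ : ∀ {n} {P : Fin n → Set} (P? : ∀ x → Dec (P x)) {x} → x ∈ decSubset P? → P x
∈-decSubset⁻ P? {x} x∈ with P? x in eq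
... | yes px = px
... | no _ with () ← trans (sym ([]=⇒lookup x∈)) (trans (lookup∘tabulate _ x) (cong does eq))

HasCount-bijection : ∀ {N k} {P Q : Subset N → Set} (g h : Subset N → Subset N) →
  (∀ W → g (h W) ≡ W) → (∀ W → h (g W) ≡ W) →
  (∀ W → P W → Q (g W)) → (∀ W → Q W → P (h W)) →
  HasCount P k → HasCount Q k
HasCount-bijection g h g∘h h∘g P⇒Q Q⇒P (f , f-inj , f-onto , f-sound) =
  (λ i → g (f i)) ,
  (λ {i} {j} e → f-inj (trans (sym (h∘g (f i))) (trans (cong h e) (h∘g (f j))))) ,
  (λ W qW → let (i , e) = f-onto (h W) (Q⇒P W qW) in i , trans (cong g e) (g∘h W)) ,
  (λ i → P⇒Q (f i) (f-sound i))

module FieldProperties {N : ℕ} (F : FiniteField N) where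

  open FiniteField F public

  commutativeRing : CommutativeRing _ _
  commutativeRing = record { isCommutativeRing = isCommutativeRing }

  open CommutativeRing commutativeRing public
    using ( +-assoc; +-comm; +-identityˡ; +-identityʳ; -‿inverseˡ; -‿inverseʳ
          ; *-assoc; *-comm; *-identityˡ; *-identityʳ; distribˡ; distribʳ; zeroˡ; zeroʳ
          ; ring; semiring; commutativeSemiring; +-commutativeMonoid )
  open import Algebra.Properties.Ring ring public
    using ( +-identityʳ-unique; +-inverseʳ-unique; x∙y⁻¹≈ε⇒x≈y; x≈y⇒x∙y⁻¹≈ε
          ; -‿distribˡ-*; -‿distribʳ-*; -1*x≈-x )

  module Solver = NaturalSolver commutativeSemiring

  open ≡-Reasoning

  AdditivePower : ℕ → Set
  AdditivePower e = ∀ x y → pow (x + y) e ≡ pow x e + pow y e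

  _≟_ : (x y : Fin N) → Dec (x ≡ y)
  _≟_ = Fin._≟_

  1≢0 : 1# ≢ 0#
  1≢0 = 0≢1 ∘ sym

  *-cancel-inverse : ∀ {x y} z → x * y ≡ 1# → y * (x * z) ≡ z
  *-cancel-inverse {x} {y} z xy≡1 = begin
    y * (x * z) ≡⟨ sym (*-assoc y x z) ⟩
    y * x * z   ≡⟨ cong (_* z) (trans (*-comm y x) xy≡1) ⟩
    1# * z      ≡⟨ *-identityˡ z ⟩
    z           ∎

  *-inverse-unique : ∀ {x y z} → x * y ≡ 1# → x * z ≡ 1# → y ≡ z
  *-inverse-unique {x} {y} {z} xy≡1 xz≡1 = begin
    y            ≡⟨ sym (*-cancel-inverse y xz≡1) ⟩
    z * (x * y)  ≡⟨ cong (z *_) xy≡1 ⟩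
    z * 1#       ≡⟨ *-identityʳ z ⟩
    z            ∎

  *≢0 : ∀ {x y} → x ≢ 0# → y ≢ 0# → x * y ≢ 0#
  *≢0 {x} {y} x≢0 y≢0 xy≡0 with inverse x x≢0
  ... | x⁻¹ , xx⁻¹≡1 = y≢0 (begin
    y             ≡⟨ sym (*-cancel-inverse y xx⁻¹≡1) ⟩
    x⁻¹ * (x * y) ≡⟨ cong (x⁻¹ *_) xy≡0 ⟩
    x⁻¹ * 0#      ≡⟨ zeroʳ x⁻¹ ⟩
    0#            ∎)

  *≡0 : ∀ x y → x * y ≡ 0# → x ≡ 0# ⊎ y ≡ 0#
  *≡0 x y xy≡0 with x ≟ 0# | y ≟ 0#
  ... | yes x≡0 | _       = inj₁ x≡0
  ... | no _    | yes y≡0 = inj₂ y≡0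
  ... | no x≢0  | no y≢0  = ⊥-elim (*≢0 x≢0 y≢0 xy≡0)

  pow-+ : ∀ x a b → pow x (a ℕ.+ b) ≡ pow x a * pow x b
  pow-+ x zero    b = sym (*-identityˡ _)
  pow-+ x (suc a) b = trans (cong (x *_) (pow-+ x a b)) (sym (*-assoc _ _ _))

  pow-distrib-* : ∀ x y n → pow (x * y) n ≡ pow x n * pow y n
  pow-distrib-* x y zero    = sym (*-identityˡ 1#)
  pow-distrib-* x y (suc n) = trans (cong ((x * y) *_) (pow-distrib-* x y n))
    (solve 4 (λ x y u v → (x :* y) :* (u :* v) := (x :* u) :* (y :* v)) refl x y (pow x n) (pow y n))
    where open Solver

  pow-1# : ∀ n → pow 1# n ≡ 1#
  pow-1# zero    = refl
  pow-1# (suc n) = trans (*-identityˡ _) (pow-1# n)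

  pow-* : ∀ x a b → pow x (a ℕ.* b) ≡ pow (pow x a) b
  pow-* x zero    b = sym (pow-1# b)
  pow-* x (suc a) b = begin
    pow x (b ℕ.+ a ℕ.* b)        ≡⟨ pow-+ x b (a ℕ.* b) ⟩
    pow x b * pow x (a ℕ.* b)    ≡⟨ cong (pow x b *_) (pow-* x a b) ⟩
    pow x b * pow (pow x a) b    ≡⟨ sym (pow-distrib-* x (pow x a) b) ⟩
    pow (x * pow x a) b          ∎

  pow≢0 : ∀ {x} n → x ≢ 0# → pow x n ≢ 0#
  pow≢0 zero    x≢0 = 1≢0
  pow≢0 (suc n) x≢0 = *≢0 x≢0 (pow≢0 n x≢0)

  pow≡0⇒≡0 : ∀ x n → pow x n ≡ 0# → x ≡ 0#
  pow≡0⇒≡0 x n xⁿ≡0 with x ≟ 0#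
  ... | yes x≡0 = x≡0
  ... | no  x≢0 = ⊥-elim (pow≢0 n x≢0 xⁿ≡0)

  pow-inverse : ∀ {x y} n → x * y ≡ 1# → pow x n * pow y n ≡ 1#
  pow-inverse {x} {y} n xy≡1 = trans (sym (pow-distrib-* x y n)) (trans (cong (λ z → pow z n) xy≡1) (pow-1# n))

  sumF-cong : ∀ {k} {f g : Fin k → Fin N} → (∀ i → f i ≡ g i) → sumF f ≡ sumF g
  sumF-cong {zero}  f≗g = refl
  sumF-cong {suc k} f≗g = cong₂ _+_ (f≗g zero) (sumF-cong (f≗g ∘ suc))

  sumF-0# : ∀ k → sumF {k} (λ _ → 0#) ≡ 0#
  sumF-0# zero    = refl
  sumF-0# (suc k) = trans (+-identityˡ _) (sumF-0# k)

  sumF-*ˡ : ∀ {k} c (f : Fin k → Fin N) → c * sumF f ≡ sumF (λ i → c * f i)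
  sumF-*ˡ {zero}  c f = zeroʳ c
  sumF-*ˡ {suc k} c f = trans (distribˡ c _ _) (cong (c * f zero +_) (sumF-*ˡ c (λ i → f (suc i))))

  sumF-+ : ∀ {k} (f g : Fin k → Fin N) → sumF (λ i → f i + g i) ≡ sumF f + sumF g
  sumF-+ {zero}  f g = sym (+-identityʳ 0#)
  sumF-+ {suc k} f g = trans (cong ((f zero + g zero) +_) (sumF-+ (λ i → f (suc i)) (λ i → g (suc i))))
    (solve 4 (λ a b c d → (a :+ b) :+ (c :+ d) := (a :+ c) :+ (b :+ d)) refl (f zero) (g zero) _ _)
    where open Solver

  sumF-homo : ∀ (φ : Fin N → Fin N) → φ 0# ≡ 0# → (∀ x y → φ (x + y) ≡ φ x + φ y) →
              ∀ {k} (f : Fin k → Fin N) → φ (sumF f) ≡ sumF (λ i → φ (f i))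
  sumF-homo φ φ-0 φ-+ {zero}  f = φ-0
  sumF-homo φ φ-0 φ-+ {suc k} f = trans (φ-+ _ _) (cong (φ (f zero) +_) (sumF-homo φ φ-0 φ-+ (λ i → f (suc i))))

  open import Algebra.Properties.CommutativeMonoid.Sum +-commutativeMonoid public using (sum)
  open import Algebra.Properties.CommutativeMonoid.Sum +-commutativeMonoid using (sum-permute)

  sum≡sumF : ∀ {k} (f : Fin k → Fin N) → sum f ≡ sumF f
  sum≡sumF {zero}  f = refl
  sum≡sumF {suc k} f = cong (f zero +_) (sum≡sumF (λ i → f (suc i)))

  sumF-permute : ∀ {k} (f : Fin k → Fin N) (π : Permutation k k) → sumF (λ i → f (π ⟨$⟩ʳ i)) ≡ sumF f
  sumF-permute {k} f π = trans (sym (sum≡sumF {k} _)) (trans (sym (sum-permute f π)) (sum≡sumF f))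

  x+y≡z+w⇒x-z≡w-y : ∀ {x y z w} → x + y ≡ z + w → x + - z ≡ w + - y
  x+y≡z+w⇒x-z≡w-y {x} {y} {z} {w} x+y≡z+w = begin
    x + - z                        ≡⟨ sym (+-identityʳ _) ⟩
    (x + - z) + 0#                 ≡⟨ cong ((x + - z) +_) (sym (-‿inverseʳ y)) ⟩
    (x + - z) + (y + - y)          ≡⟨ solve 4 (λ x -z y -y → (x :+ -z) :+ (y :+ -y) := (x :+ y) :+ (-y :+ -z)) refl x (- z) y (- y) ⟩
    (x + y) + (- y + - z)          ≡⟨ cong (_+ (- y + - z)) x+y≡z+w ⟩
    (z + w) + (- y + - z)          ≡⟨ solve 4 (λ z w -y -z → (z :+ w) :+ (-y :+ -z) := (w :+ -y) :+ (z :+ -z)) refl z w (- y) (- z) ⟩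
    (w + - y) + (z + - z)          ≡⟨ cong ((w + - y) +_) (-‿inverseʳ z) ⟩
    (w + - y) + 0#                 ≡⟨ +-identityʳ _ ⟩
    w + - y                        ∎
    where open Solver

  mobius-inverse : ∀ {a b c d γ β} → β * (c * γ + d) ≡ a * γ + b → (β * c + - a) * γ ≡ b + - (β * d)
  mobius-inverse {a} {b} {c} {d} {γ} {β} β≡ = begin
    (β * c + - a) * γ          ≡⟨ distribʳ γ _ _ ⟩
    β * c * γ + - a * γ        ≡⟨ cong (β * c * γ +_) (sym (-‿distribˡ-* a γ)) ⟩
    β * c * γ + - (a * γ)      ≡⟨ x+y≡z+w⇒x-z≡w-y (trans (solve 4 (λ β c γ d → β :* c :* γ :+ β :* d := β :* (c :* γ :+ d)) refl β c γ d) β≡) ⟩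
    b + - (β * d)              ∎
    where open Solver

  mobius-inverse-denominator≢0 : ∀ {a b c d γ β} → (a * d) - (b * c) ≢ 0# →
                                 β * (c * γ + d) ≡ a * γ + b → β * c + - a ≢ 0#
  mobius-inverse-denominator≢0 {a} {b} {c} {d} {γ} {β} det≢0 β≡ s≡0 = det≢0 (begin
    a * d + - (b * c)              ≡⟨ cong₂ (λ x y → x * d + - (y * c)) (sym βc≡a) (sym βd≡b) ⟩
    β * c * d + - (β * d * c)      ≡⟨ cong (λ z → β * c * d + - z) (solve 3 (λ β c d → β :* d :* c := β :* c :* d) refl β c d) ⟩
    β * c * d + - (β * c * d)      ≡⟨ -‿inverseʳ _ ⟩
    0#                             ∎)
    where
    open Solver
    βc≡a : β * c ≡ a
    βc≡a = x∙y⁻¹≈ε⇒x≈y _ _ s≡0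
    βd≡b : β * d ≡ b
    βd≡b = sym (x∙y⁻¹≈ε⇒x≈y _ _ (trans (sym (mobius-inverse β≡)) (trans (cong (_* γ) s≡0) (zeroˡ γ))))

  mobius-c≡0 : ∀ {a b d d⁻¹ γ β} → d * d⁻¹ ≡ 1# → β * (0# * γ + d) ≡ a * γ + b → β ≡ (a * d⁻¹) * γ + b * d⁻¹
  mobius-c≡0 {a} {b} {d} {d⁻¹} {γ} {β} dd⁻¹≡1 β≡ = begin
    β                          ≡⟨ sym (*-identityʳ β) ⟩
    β * 1#                     ≡⟨ cong (β *_) (sym dd⁻¹≡1) ⟩
    β * (d * d⁻¹)              ≡⟨ sym (*-assoc _ _ _) ⟩
    β * d * d⁻¹                ≡⟨ cong (λ z → β * z * d⁻¹) (sym (trans (cong (_+ d) (zeroˡ γ)) (+-identityˡ d))) ⟩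
    β * (0# * γ + d) * d⁻¹     ≡⟨ cong (_* d⁻¹) β≡ ⟩
    (a * γ + b) * d⁻¹          ≡⟨ solve 4 (λ a γ b d⁻¹ → (a :* γ :+ b) :* d⁻¹ := (a :* d⁻¹) :* γ :+ b :* d⁻¹) refl a γ b d⁻¹ ⟩
    (a * d⁻¹) * γ + b * d⁻¹    ∎
    where open Solver

  -- Partial fractions: (a γ + b) / (c γ + d) = (b - a d / c) / (c γ + d) + a / c.
  mobius-c≢0 : ∀ {a b c d c⁻¹ δ γ β} → c * c⁻¹ ≡ 1# → (c * γ + d) * δ ≡ 1# → β * (c * γ + d) ≡ a * γ + b →
               β ≡ (b + - (a * c⁻¹ * d)) * δ + a * c⁻¹
  mobius-c≢0 {a} {b} {c} {d} {c⁻¹} {δ} {γ} {β} cc⁻¹≡1 [cγ+d]δ≡1 β≡ = begin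
    β                                              ≡⟨ sym (*-identityʳ β) ⟩
    β * 1#                                         ≡⟨ cong (β *_) (sym [cγ+d]δ≡1) ⟩
    β * ((c * γ + d) * δ)                          ≡⟨ sym (*-assoc _ _ _) ⟩
    β * (c * γ + d) * δ                            ≡⟨ cong (_* δ) β≡ ⟩
    (a * γ + b) * δ
      ≡⟨ cong (λ z → (z + b) * δ) (sym (trans (cong (λ z → a * z * γ) cc⁻¹≡1) (cong (_* γ) (*-identityʳ a)))) ⟩
    (a * (c * c⁻¹) * γ + b) * δ                    ≡⟨ cong (_* δ) (sym (+-identityʳ _)) ⟩
    (a * (c * c⁻¹) * γ + b + 0#) * δ               ≡⟨ cong (λ z → (a * (c * c⁻¹) * γ + b + z) * δ) (sym (-‿inverseˡ (a * c⁻¹ * d))) ⟩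
    (a * (c * c⁻¹) * γ + b + (X + a * c⁻¹ * d)) * δ
                                                   ≡⟨ solve 8 (λ a c c⁻¹ γ b X d δ → (a :* (c :* c⁻¹) :* γ :+ b :+ (X :+ a :* c⁻¹ :* d)) :* δ
                                                                 := (b :+ X) :* δ :+ a :* c⁻¹ :* ((c :* γ :+ d) :* δ)) refl a c c⁻¹ γ b X d δ ⟩
    (b + X) * δ + a * c⁻¹ * ((c * γ + d) * δ)      ≡⟨ cong (λ z → (b + X) * δ + a * c⁻¹ * z) [cγ+d]δ≡1 ⟩
    (b + X) * δ + a * c⁻¹ * 1#                     ≡⟨ cong ((b + X) * δ +_) (*-identityʳ _) ⟩
    (b + X) * δ + a * c⁻¹                          ∎
    where
    open Solver
    X = - (a * c⁻¹ * d)

module PrimePowerOrder {N : ℕ} (F : FiniteField N) {p e : ℕ} (p-prime : Prime p) (N≡pᵉ : N ≡ p ℕ.^ e) where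

  open FieldProperties F
  open import Algebra.Properties.CommutativeMonoid.Sum +-commutativeMonoid
    using (sum-permute; ∑-distrib-+; sum-replicate; sum-replicate-zero; sum-cong-≗; sum-init-last)
  open import Algebra.Properties.Semiring.Mult semiring using (×1-homo-*; ×-assoc-*; ×-assocˡ) renaming (_×_ to _·_)
  open import Algebra.Properties.Semiring.Exp semiring using (_^_)
  import Algebra.Properties.CommutativeSemiring.Binomial commutativeSemiring as Binomial
  open ≡-Reasoning

  -- Translating by 1# permutes the field, so Σ x = Σ (x + 1#) = Σ x + N · 1#.
  N·1#≡0# : N · 1# ≡ 0#
  N·1#≡0# = +-identityʳ-unique (sum id) (N · 1#) (sym sum-shifted)
    where
    shift : Permutation N N
    shift = permutation (_+ 1#) (_+ - 1#)
      (λ y → trans (+-assoc _ _ _) (trans (cong (y +_) (-‿inverseˡ 1#)) (+-identityʳ y)))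
      (λ y → trans (+-assoc _ _ _) (trans (cong (y +_) (-‿inverseʳ 1#)) (+-identityʳ y)))
    sum-shifted : sum id ≡ sum id + N · 1#
    sum-shifted = trans (sum-permute id shift) (trans (∑-distrib-+ id (λ _ → 1#)) (cong (sum id +_) (sum-replicate N)))

  ^·1#≡pow : ∀ a j → (a ℕ.^ j) · 1# ≡ pow (a · 1#) j
  ^·1#≡pow a zero    = +-identityʳ 1#
  ^·1#≡pow a (suc j) = trans (×1-homo-* a (a ℕ.^ j)) (cong ((a · 1#) *_) (^·1#≡pow a j))

  p·1#≡0# : p · 1# ≡ 0#
  p·1#≡0# = pow≡0⇒≡0 (p · 1#) e (trans (sym (^·1#≡pow p e)) (trans (cong (_· 1#) (sym N≡pᵉ)) N·1#≡0#))

  p∣⇒·≡0# : ∀ {c} z → p ∣ c → c · z ≡ 0#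
  p∣⇒·≡0# z (divides k refl) = begin
    (k ℕ.* p) · z         ≡⟨ sym (×-assocˡ z k p) ⟩
    k · (p · z)           ≡⟨ cong (λ w → k · (p · w)) (sym (*-identityˡ z)) ⟩
    k · (p · (1# * z))    ≡⟨ cong (k ·_) (sym (×-assoc-* p 1# z)) ⟩
    k · ((p · 1#) * z)    ≡⟨ cong (λ w → k · (w * z)) p·1#≡0# ⟩
    k · (0# * z)          ≡⟨ cong (k ·_) (zeroˡ z) ⟩
    k · 0#                ≡⟨ ·-0# k ⟩
    0#                    ∎
    where
    ·-0# : ∀ k → k · 0# ≡ 0#
    ·-0# zero    = refl
    ·-0# (suc k) = trans (+-identityˡ _) (·-0# k)

  pow≡^ : ∀ z n → pow z n ≡ z ^ n
  pow≡^ z zero    = refl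
  pow≡^ z (suc n) = cong (z *_) (pow≡^ z n)

  -- In the binomial expansion of (x + y) ^ r only the two outer terms survive.
  pow-prime-+ : ∀ {r} → Prime r → (∀ {c} z → r ∣ c → c · z ≡ 0#) → AdditivePower r
  pow-prime-+ {suc r-1} r-prime r∣⇒·≡0# x y = begin
    pow (x + y) r                                  ≡⟨ pow≡^ (x + y) r ⟩
    (x + y) ^ r                                    ≡⟨ Binomial.theorem r x y ⟩
    t zero + sum (λ i → t (suc i))                 ≡⟨ cong (t zero +_) (sum-init-last (λ i → t (suc i))) ⟩
    t zero + (sum (λ i → t (suc (inject₁ i))) + t (fromℕ r))
                                                   ≡⟨ cong₂ (λ u v → t zero + (u + v)) middle-vanishes last-term ⟩
    t zero + (0# + pow x r)                        ≡⟨ cong₂ _+_ first-term (+-identityˡ _) ⟩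
    pow y r + pow x r                              ≡⟨ +-comm _ _ ⟩
    pow x r + pow y r                              ∎
    where
    r = suc r-1
    t = Binomial.binomialTerm x y r
    first-term : t zero ≡ pow y r
    first-term = trans (+-identityʳ _) (trans (*-identityˡ _) (sym (pow≡^ y r)))
    last-term : t (fromℕ r) ≡ pow x r
    last-term = begin
      (r C toℕ (fromℕ r)) · ((x ^ toℕ (fromℕ r)) * (y ^ (r ∸ toℕ (fromℕ r))))
        ≡⟨ cong (λ j → (r C j) · ((x ^ j) * (y ^ (r ∸ j)))) (Fin.toℕ-fromℕ r) ⟩
      (r C r) · ((x ^ r) * (y ^ (r ∸ r)))  ≡⟨ cong₂ (λ a b → a · ((x ^ r) * (y ^ b))) (nCn≡1 r) (ℕ.n∸n≡0 r) ⟩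
      1 · ((x ^ r) * 1#)                    ≡⟨ trans (+-identityʳ _) (*-identityʳ _) ⟩
      x ^ r                                 ≡⟨ sym (pow≡^ x r) ⟩
      pow x r                               ∎
    middle-vanishes : sum (λ i → t (suc (inject₁ i))) ≡ 0#
    middle-vanishes = trans (sum-cong-≗ (λ i → r∣⇒·≡0# _ (prime∣pCk r-prime (s≤s z≤n)
                        (subst (ℕ._< r) (sym (cong suc (Fin.toℕ-inject₁ i))) (s≤s (Fin.toℕ<n i))))))
                      (sum-replicate-zero r-1)

  pow-p-+ : AdditivePower p
  pow-p-+ = pow-prime-+ p-prime p∣⇒·≡0#

  pow-pʲ-+ : ∀ j → AdditivePower (p ℕ.^ j)
  pow-pʲ-+ zero    x y = distribʳ 1# x y
  pow-pʲ-+ (suc j) x y = begin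
    pow (x + y) (p ℕ.* p ℕ.^ j)                      ≡⟨ pow-* (x + y) p (p ℕ.^ j) ⟩
    pow (pow (x + y) p) (p ℕ.^ j)                    ≡⟨ cong (λ z → pow z (p ℕ.^ j)) (pow-p-+ x y) ⟩
    pow (pow x p + pow y p) (p ℕ.^ j)                ≡⟨ pow-pʲ-+ j (pow x p) (pow y p) ⟩
    pow (pow x p) (p ℕ.^ j) + pow (pow y p) (p ℕ.^ j) ≡⟨ sym (cong₂ _+_ (pow-* x p (p ℕ.^ j)) (pow-* y p (p ℕ.^ j))) ⟩
    pow x (p ℕ.* p ℕ.^ j) + pow y (p ℕ.* p ℕ.^ j)    ∎

-- Polynomials are coefficient lists, constant term first.
module Polynomials {N : ℕ} (F : FiniteField N) where

  open FieldProperties F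
  open ≡-Reasoning

  eval : List (Fin N) → Fin N → Fin N
  eval []       x = 0#
  eval (c ∷ cs) x = c + x * eval cs x

  IsZero : List (Fin N) → Set
  IsZero = All (_≡ 0#)

  -- Synthetic division by (x - r): the quotient has coefficients eval cs r for the tails cs.
  quotient : Fin N → List (Fin N) → List (Fin N)
  quotient r []                = []
  quotient r (c ∷ [])          = []
  quotient r (c ∷ cs@(_ ∷ _)) = eval cs r ∷ quotient r cs

  length-quotient : ∀ r P → length (quotient r P) ≡ pred (length P)
  length-quotient r []                = refl
  length-quotient r (c ∷ [])          = refl
  length-quotient r (c ∷ cs@(_ ∷ _)) = cong suc (length-quotient r cs)

  eval-division : ∀ r P x → eval P x ≡ (x - r) * eval (quotient r P) x + eval P r
  eval-division r [] x = sym (trans (cong (_+ 0#) (zeroʳ _)) (+-identityʳ 0#))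
  eval-division r (c ∷ []) x = begin
    c + x * 0#                    ≡⟨ cong (c +_) (trans (zeroʳ x) (sym (zeroʳ r))) ⟩
    c + r * 0#                    ≡⟨ sym (+-identityˡ _) ⟩
    0# + (c + r * 0#)             ≡⟨ cong (_+ (c + r * 0#)) (sym (zeroʳ (x - r))) ⟩
    (x - r) * 0# + (c + r * 0#)   ∎
  eval-division r (c ∷ cs@(_ ∷ _)) x = begin
    c + x * eval cs x                                  ≡⟨ cong (λ z → c + x * z) (eval-division r cs x) ⟩
    c + x * ((x - r) * Q + E)                          ≡⟨ sym (+-identityʳ _) ⟩
    c + x * ((x - r) * Q + E) + 0#                     ≡⟨ cong (c + x * ((x - r) * Q + E) +_) (sym (trans (cong (_* E) (-‿inverseʳ r)) (zeroˡ E))) ⟩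
    c + x * ((x + - r) * Q + E) + (r + - r) * E        ≡⟨ solve 6 (λ c x -r Q E r → c :+ x :* ((x :+ -r) :* Q :+ E) :+ (r :+ -r) :* E
                                                                 := (x :+ -r) :* (E :+ x :* Q) :+ (c :+ r :* E)) refl c x (- r) Q E r ⟩
    (x - r) * (E + x * Q) + (c + r * E)                ∎
    where
    open Solver
    Q = eval (quotient r cs) x
    E = eval cs r

  quotient-zero⇒zero : ∀ r P → IsZero (quotient r P) → eval P r ≡ 0# → IsZero P
  quotient-zero⇒zero r []                _         _       = []
  quotient-zero⇒zero r (c ∷ [])          _         P[r]≡0 =
    trans (sym (+-identityʳ c)) (trans (cong (c +_) (sym (zeroʳ r))) P[r]≡0) ∷ []
  quotient-zero⇒zero r (c ∷ cs@(_ ∷ _)) (cs[r]≡0 ∷ Q≡0) P[r]≡0 =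
    trans (sym (+-identityʳ c)) (trans (cong (c +_) (sym (trans (cong (r *_) cs[r]≡0) (zeroʳ r)))) P[r]≡0)
    ∷ quotient-zero⇒zero r cs Q≡0 cs[r]≡0

  roots⇒zero : ∀ L P → length P ≡ L → (ρ : Fin L → Fin N) → Injective _≡_ _≡_ ρ →
               (∀ i → eval P (ρ i) ≡ 0#) → IsZero P
  roots⇒zero zero    []  _     ρ ρ-inj roots = []
  roots⇒zero (suc L) P   |P|≡L ρ ρ-inj roots =
    quotient-zero⇒zero r P (roots⇒zero L (quotient r P) |Q|≡L (ρ ∘ suc) (Fin.suc-injective ∘ ρ-inj) Q-roots) (roots zero)
    where
    r = ρ zero
    |Q|≡L : length (quotient r P) ≡ L
    |Q|≡L = trans (length-quotient r P) (cong pred |P|≡L)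
    factors-vanish : ∀ x → eval P x ≡ 0# → (x - r) * eval (quotient r P) x ≡ 0#
    factors-vanish x P[x]≡0 = begin
      (x - r) * eval (quotient r P) x               ≡⟨ sym (+-identityʳ _) ⟩
      (x - r) * eval (quotient r P) x + 0#          ≡⟨ cong ((x - r) * eval (quotient r P) x +_) (sym (roots zero)) ⟩
      (x - r) * eval (quotient r P) x + eval P r    ≡⟨ sym (eval-division r P x) ⟩
      eval P x                                      ≡⟨ P[x]≡0 ⟩
      0#                                            ∎
    Q-roots : ∀ i → eval (quotient r P) (ρ (suc i)) ≡ 0#
    Q-roots i with *≡0 _ _ (factors-vanish (ρ (suc i)) (roots (suc i)))
    ... | inj₂ Q≡0 = Q≡0
    ... | inj₁ ρᵢ-r≡0 with () ← ρ-inj (x∙y⁻¹≈ε⇒x≈y _ _ ρᵢ-r≡0)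

  monomial : ℕ → List (Fin N)
  monomial zero    = 1# ∷ []
  monomial (suc j) = 0# ∷ monomial j

  eval-monomial : ∀ j x → eval (monomial j) x ≡ pow x j
  eval-monomial zero    x = trans (cong (1# +_) (zeroʳ x)) (+-identityʳ 1#)
  eval-monomial (suc j) x = trans (+-identityˡ _) (cong (x *_) (eval-monomial j x))

  length-monomial : ∀ j → length (monomial j) ≡ suc j
  length-monomial zero    = refl
  length-monomial (suc j) = cong suc (length-monomial j)

  monomial≢0 : ∀ j → ¬ IsZero (monomial j)
  monomial≢0 zero    (1≡0 ∷ _) = 1≢0 1≡0
  monomial≢0 (suc j) (_ ∷ zs)  = monomial≢0 j zs

  -- x ^ (2 + j) - x has at most 2 + j roots.
  pow-fixes-all⇒≤ : ∀ j → (∀ x → pow x (2 ℕ.+ j) ≡ x) → N ≤ 2 ℕ.+ j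
  pow-fixes-all⇒≤ j fixes with N ℕ.≤? 2 ℕ.+ j
  ... | yes N≤ = N≤
  ... | no  N≰ = ⊥-elim (monomial≢0 j (drop-two (roots⇒zero (3 ℕ.+ j) P |P|≡ ρ ρ-inj P-roots)))
    where
    P : List (Fin N)
    P = 0# ∷ - 1# ∷ monomial j
    |P|≡ : length P ≡ 3 ℕ.+ j
    |P|≡ = cong (λ l → suc (suc l)) (length-monomial j)
    3+j≤N : 3 ℕ.+ j ≤ N
    3+j≤N = ℕ.≰⇒> N≰
    ρ : Fin (3 ℕ.+ j) → Fin N
    ρ i = inject≤ i 3+j≤N
    ρ-inj : Injective _≡_ _≡_ ρ
    ρ-inj {a} {b} = Fin.inject≤-injective 3+j≤N 3+j≤N a b
    P-roots : ∀ i → eval P (ρ i) ≡ 0#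
    P-roots i = let x = ρ i in begin
      0# + x * (- 1# + x * eval (monomial j) x)       ≡⟨ +-identityˡ _ ⟩
      x * (- 1# + x * eval (monomial j) x)            ≡⟨ distribˡ x _ _ ⟩
      x * - 1# + x * (x * eval (monomial j) x)        ≡⟨ cong₂ _+_ (trans (sym (-‿distribʳ-* x 1#)) (cong -_ (*-identityʳ x)))
                                                                   (cong (λ z → x * (x * z)) (eval-monomial j x)) ⟩
      - x + pow x (2 ℕ.+ j)                           ≡⟨ cong (- x +_) (fixes x) ⟩
      - x + x                                         ≡⟨ -‿inverseˡ x ⟩
      0#                                              ∎
    drop-two : ∀ {a b cs} → IsZero (a ∷ b ∷ cs) → IsZero cs
    drop-two (_ ∷ _ ∷ zs) = zs

module Automorphisms {N : ℕ} (F : FiniteField N) where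

  open FieldProperties F

  record Automorphism : Set where
    field
      to from : Fin N → Fin N
      from-to : ∀ x → from (to x) ≡ x
      to-from : ∀ x → to (from x) ≡ x
      to-+ : ∀ x y → to (x + y) ≡ to x + to y
      to-* : ∀ x y → to (x * y) ≡ to x * to y

    to-injective : ∀ {x y} → to x ≡ to y → x ≡ y
    to-injective {x} {y} e = trans (sym (from-to x)) (trans (cong from e) (from-to y))

    to-0# : to 0# ≡ 0#
    to-0# = +-identityʳ-unique (to 0#) (to 0#) (trans (sym (to-+ 0# 0#)) (cong to (+-identityʳ 0#)))

    to-1# : to 1# ≡ 1#
    to-1# = begin
      to 1#                 ≡⟨ sym (*-identityʳ (to 1#)) ⟩
      to 1# * 1#            ≡⟨ cong (to 1# *_) (sym (to-from 1#)) ⟩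
      to 1# * to (from 1#)  ≡⟨ sym (to-* 1# (from 1#)) ⟩
      to (1# * from 1#)     ≡⟨ cong to (*-identityˡ (from 1#)) ⟩
      to (from 1#)          ≡⟨ to-from 1# ⟩
      1#                    ∎
      where open ≡-Reasoning

    to-neg : ∀ x → to (- x) ≡ - to x
    to-neg x = +-inverseʳ-unique (to x) (to (- x)) (trans (sym (to-+ x (- x))) (trans (cong to (-‿inverseʳ x)) to-0#))

    to-pow : ∀ x n → to (pow x n) ≡ pow (to x) n
    to-pow x zero    = to-1#
    to-pow x (suc n) = trans (to-* x (pow x n)) (cong (to x *_) (to-pow x n))

    inverse-automorphism : Automorphism
    inverse-automorphism = record
      { to = from ; from = to ; from-to = to-from ; to-from = from-to
      ; to-+ = λ x y → to-injective (trans (to-from (x + y)) (sym (trans (to-+ _ _) (cong₂ _+_ (to-from x) (to-from y)))))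
      ; to-* = λ x y → to-injective (trans (to-from (x * y)) (sym (trans (to-* _ _) (cong₂ _*_ (to-from x) (to-from y)))))
      }

  injective⇒automorphism : (φ : Fin N → Fin N) → (∀ {x y} → φ x ≡ φ y → x ≡ y) →
    (∀ x y → φ (x + y) ≡ φ x + φ y) → (∀ x y → φ (x * y) ≡ φ x * φ y) → Automorphism
  injective⇒automorphism φ φ-inj φ-+ φ-* = record
    { to = φ ; from = φ⁻¹ ; from-to = λ x → φ-inj (φ∘φ⁻¹ (φ x)) ; to-from = φ∘φ⁻¹ ; to-+ = φ-+ ; to-* = φ-* }
    where
    φ⁻¹ : Fin N → Fin N
    φ⁻¹ y = proj₁ (injective⇒surjective φ φ-inj y)
    φ∘φ⁻¹ : ∀ y → φ (φ⁻¹ y) ≡ y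
    φ∘φ⁻¹ y = proj₂ (injective⇒surjective φ φ-inj y)

module OverFq {N : ℕ} (F : FiniteField N) (q : ℕ)
              (pow-q-+ : FieldProperties.AdditivePower F q) where

  open FieldProperties F
  open Automorphisms F
  open FieldDefs F q
  open ≡-Reasoning

  Fq-0# : InFq 0#
  Fq-0# = +-identityʳ-unique (pow 0# q) (pow 0# q) (sym (trans (cong (λ z → pow z q) (sym (+-identityʳ 0#))) (pow-q-+ 0# 0#)))

  Fq-1# : InFq 1#
  Fq-1# = pow-1# q

  Fq-+ : ∀ {x y} → InFq x → InFq y → InFq (x + y)
  Fq-+ {x} {y} x∈ y∈ = trans (pow-q-+ x y) (cong₂ _+_ x∈ y∈)

  Fq-* : ∀ {x y} → InFq x → InFq y → InFq (x * y)
  Fq-* {x} {y} x∈ y∈ = trans (pow-distrib-* x y q) (cong₂ _*_ x∈ y∈)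

  Fq-neg : ∀ {x} → InFq x → InFq (- x)
  Fq-neg {x} x∈ = trans (+-inverseʳ-unique (pow x q) (pow (- x) q)
                          (trans (sym (pow-q-+ x (- x))) (trans (cong (λ z → pow z q) (-‿inverseʳ x)) Fq-0#)))
                        (cong -_ x∈)

  Fq-inverse : ∀ {x y} → InFq x → x * y ≡ 1# → InFq y
  Fq-inverse {x} {y} x∈ xy≡1 = *-inverse-unique xyᵠ≡1 xy≡1
    where
    xyᵠ≡1 : x * pow y q ≡ 1#
    xyᵠ≡1 = trans (cong (_* pow y q) (sym x∈))
              (trans (sym (pow-distrib-* x y q)) (trans (cong (λ z → pow z q) xy≡1) Fq-1#))

  Fq-pow : ∀ {x} n → InFq x → InFq (pow x n)
  Fq-pow zero    x∈ = Fq-1#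
  Fq-pow (suc n) x∈ = Fq-* x∈ (Fq-pow n x∈)

  Fq : Subset N
  Fq = decSubset (λ x → pow x q ≟ x)

  ∈Fq⁺ : ∀ {x} → InFq x → x ∈ Fq
  ∈Fq⁺ = ∈-decSubset⁺ (λ x → pow x q ≟ x)

  ∈Fq⁻ : ∀ {x} → x ∈ Fq → InFq x
  ∈Fq⁻ = ∈-decSubset⁻ (λ x → pow x q ≟ x)

  Fq-isSubfield : IsSubfield Fq
  Fq-isSubfield =
    ∈Fq⁺ Fq-0# , ∈Fq⁺ Fq-1# ,
    (λ _ _ x∈ y∈ → ∈Fq⁺ (Fq-+ (∈Fq⁻ x∈) (∈Fq⁻ y∈))) ,
    (λ _ x∈ → ∈Fq⁺ (Fq-neg (∈Fq⁻ x∈))) ,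
    (λ _ _ x∈ y∈ → ∈Fq⁺ (Fq-* (∈Fq⁻ x∈) (∈Fq⁻ y∈))) ,
    (λ _ _ x∈ xy≡1 → ∈Fq⁺ (Fq-inverse (∈Fq⁻ x∈) xy≡1))

  Generates⇒all-in-Fq : ∀ {γ} → Generates γ → InFq γ → ∀ x → InFq x
  Generates⇒all-in-Fq γ-gen γ∈ x = ∈Fq⁻ (γ-gen Fq Fq-isSubfield (λ _ → ∈Fq⁺) (∈Fq⁺ γ∈) x)

  ∉Fq⇒≢0 : ∀ {γ} → ¬ InFq γ → γ ≢ 0#
  ∉Fq⇒≢0 γ∉ γ≡0 = γ∉ (subst InFq (sym γ≡0) Fq-0#)

  ∉Fq-*ˡ : ∀ {a γ} → InFq a → a ≢ 0# → ¬ InFq γ → ¬ InFq (a * γ)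
  ∉Fq-*ˡ {a} {γ} a∈ a≢0 γ∉ aγ∈ with inverse a a≢0
  ... | a⁻¹ , aa⁻¹≡1 = γ∉ (subst InFq (*-cancel-inverse γ aa⁻¹≡1) (Fq-* (Fq-inverse a∈ aa⁻¹≡1) aγ∈))

  ∉Fq-+ʳ : ∀ {γ b} → InFq b → ¬ InFq γ → ¬ InFq (γ + b)
  ∉Fq-+ʳ {γ} {b} b∈ γ∉ γ+b∈ = γ∉ (subst InFq γ+b-b≡γ (Fq-+ γ+b∈ (Fq-neg b∈)))
    where
    γ+b-b≡γ : γ + b + - b ≡ γ
    γ+b-b≡γ = trans (+-assoc γ b (- b)) (trans (cong (γ +_) (-‿inverseʳ b)) (+-identityʳ γ))

  ∉Fq-inverse : ∀ {γ δ} → γ * δ ≡ 1# → ¬ InFq γ → ¬ InFq δ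
  ∉Fq-inverse {γ} γδ≡1 γ∉ δ∈ = γ∉ (Fq-inverse δ∈ (trans (*-comm _ γ) γδ≡1))

  FixesFq : Automorphism → Set
  FixesFq φ = ∀ {c} → InFq c → Automorphism.to φ c ≡ c

  inverse-fixesFq : ∀ φ → FixesFq φ → FixesFq (Automorphism.inverse-automorphism φ)
  inverse-fixesFq φ φ-fix {c} c∈ = trans (cong from (sym (φ-fix c∈))) (from-to c)
    where open Automorphism φ

  Generates-automorphism : ∀ φ → FixesFq φ → ∀ {γ} → Generates γ → Generates (Automorphism.to φ γ)
  Generates-automorphism φ φ-fix {γ} γ-gen K (0∈ , 1∈ , +∈ , -∈ , *∈ , ⁻¹∈) Fq⊆K φγ∈K y =
    subst (_∈ K) (to-from y) (∈-preimage⁻ to K (γ-gen K′ K′-isSubfield Fq⊆K′ (∈-preimage⁺ to K φγ∈K) (from y)))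
    where
    open Automorphism φ
    K′ : Subset N
    K′ = preimage to K
    pull : ∀ {x} → to x ∈ K → x ∈ K′
    pull = ∈-preimage⁺ to K
    push : ∀ {x} → x ∈ K′ → to x ∈ K
    push = ∈-preimage⁻ to K
    Fq⊆K′ : ∀ x → InFq x → x ∈ K′
    Fq⊆K′ x x∈ = pull (subst (_∈ K) (sym (φ-fix x∈)) (Fq⊆K x x∈))
    K′-isSubfield : IsSubfield K′
    K′-isSubfield =
      pull (subst (_∈ K) (sym to-0#) 0∈) , pull (subst (_∈ K) (sym to-1#) 1∈) ,
      (λ x y x∈ y∈ → pull (subst (_∈ K) (sym (to-+ x y)) (+∈ _ _ (push x∈) (push y∈)))) ,
      (λ x x∈ → pull (subst (_∈ K) (sym (to-neg x)) (-∈ _ (push x∈)))) ,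
      (λ x y x∈ y∈ → pull (subst (_∈ K) (sym (to-* x y)) (*∈ _ _ (push x∈) (push y∈)))) ,
      (λ x y x∈ xy≡1 → pull (⁻¹∈ (to x) (to y) (push x∈) (trans (sym (to-* x y)) (trans (cong to xy≡1) to-1#))))

  frobenius : ℕ → Fin N → Fin N
  frobenius r x = pow x (q ℕ.^ r)

  frobenius-+ : ∀ r x y → frobenius r (x + y) ≡ frobenius r x + frobenius r y
  frobenius-+ zero    x y = distribʳ 1# x y
  frobenius-+ (suc r) x y = begin
    pow (x + y) (q ℕ.* q ℕ.^ r)                        ≡⟨ pow-* (x + y) q (q ℕ.^ r) ⟩
    pow (pow (x + y) q) (q ℕ.^ r)                      ≡⟨ cong (λ z → pow z (q ℕ.^ r)) (pow-q-+ x y) ⟩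
    pow (pow x q + pow y q) (q ℕ.^ r)                  ≡⟨ frobenius-+ r (pow x q) (pow y q) ⟩
    pow (pow x q) (q ℕ.^ r) + pow (pow y q) (q ℕ.^ r)  ≡⟨ sym (cong₂ _+_ (pow-* x q (q ℕ.^ r)) (pow-* y q (q ℕ.^ r))) ⟩
    pow x (q ℕ.* q ℕ.^ r) + pow y (q ℕ.* q ℕ.^ r)      ∎

  frobenius-fixesFq : ∀ r {c} → InFq c → frobenius r c ≡ c
  frobenius-fixesFq zero    {c} c∈ = *-identityʳ c
  frobenius-fixesFq (suc r) {c} c∈ =
    trans (pow-* c q (q ℕ.^ r)) (trans (cong (λ z → pow z (q ℕ.^ r)) c∈) (frobenius-fixesFq r c∈))

  frobenius-injective : ∀ r {x y} → frobenius r x ≡ frobenius r y → x ≡ y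
  frobenius-injective r {x} {y} σx≡σy =
    x∙y⁻¹≈ε⇒x≈y x y (pow≡0⇒≡0 (x - y) (q ℕ.^ r)
      (trans (frobenius-+ r x (- y)) (trans (cong (frobenius r x +_) σ-neg) (x≈y⇒x∙y⁻¹≈ε σx≡σy))))
    where
    σ-neg : frobenius r (- y) ≡ - frobenius r y
    σ-neg = +-inverseʳ-unique (frobenius r y) (frobenius r (- y))
              (trans (sym (frobenius-+ r y (- y))) (trans (cong (frobenius r) (-‿inverseʳ y)) (frobenius-fixesFq r Fq-0#)))

  frobenius-automorphism : ℕ → Automorphism
  frobenius-automorphism r =
    injective⇒automorphism (frobenius r) (frobenius-injective r) (frobenius-+ r) (λ x y → pow-distrib-* x y (q ℕ.^ r))

  InFq-automorphism⁻ : ∀ φ {x} → InFq (Automorphism.to φ x) → InFq x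
  InFq-automorphism⁻ φ {x} φx∈ = to-injective (trans (to-pow x q) φx∈)
    where open Automorphism φ

  generator∉Fq : 2 ≤ q → q < N → ∀ {γ} → Generates γ → ¬ InFq γ
  generator∉Fq (ℕ.s≤s (ℕ.s≤s {n = j} _)) q<N γ-gen γ∈ =
    ℕ.<⇒≱ q<N (pow-fixes-all⇒≤ j (Generates⇒all-in-Fq γ-gen γ∈))
    where open Polynomials F

  ∈-subfield-mobius : ∀ {K a b c d γ β} → IsSubfield K → (∀ x → InFq x → x ∈ K) →
    InFq a → InFq b → InFq c → InFq d → (a * d) - (b * c) ≢ 0# → β * (c * γ + d) ≡ a * γ + b → β ∈ K → γ ∈ K
  ∈-subfield-mobius {K} {a} {b} {c} {d} {γ} {β} (_ , _ , +∈ , -∈ , *∈ , ⁻¹∈) Fq⊆K a∈ b∈ c∈ d∈ det≢0 β≡ β∈K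
    with inverse (β * c + - a) (mobius-inverse-denominator≢0 det≢0 β≡)
  ... | s⁻¹ , ss⁻¹≡1 =
    subst (_∈ K) (trans (cong (s⁻¹ *_) (sym (mobius-inverse β≡))) (*-cancel-inverse γ ss⁻¹≡1))
      (*∈ _ _ (⁻¹∈ _ _ s∈K ss⁻¹≡1) (+∈ _ _ (Fq⊆K b b∈) (-∈ _ (*∈ _ _ β∈K (Fq⊆K d d∈)))))
    where
    s∈K : β * c + - a ∈ K
    s∈K = +∈ _ _ (*∈ _ _ β∈K (Fq⊆K c c∈)) (-∈ _ (Fq⊆K a a∈))

  affine-coefficient≢0 : ∀ {A B x β} → InFq B → ¬ InFq β → β ≡ A * x + B → A ≢ 0#
  affine-coefficient≢0 {A} {B} {x} B∈ β∉ β≡ A≡0 =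
    β∉ (subst InFq (sym (trans β≡ (trans (cong (λ z → z * x + B) A≡0) (trans (cong (_+ B) (zeroˡ x)) (+-identityˡ B))))) B∈)

module SplittingSubspaces {N : ℕ} (F : FiniteField N) (q : ℕ)
              (pow-q-+ : FieldProperties.AdditivePower F q) where

  open FieldProperties F
  open Automorphisms F
  open FieldDefs F q
  open OverFq F q pow-q-+
  open ≡-Reasoning

  record FqLinearEquiv : Set where
    field
      to from : Fin N → Fin N
      from-to : ∀ x → from (to x) ≡ x
      to-from : ∀ x → to (from x) ≡ x
      to-+ : ∀ x y → to (x + y) ≡ to x + to y
      to-scale : ∀ {c} x → InFq c → to (c * x) ≡ c * to x

    image : Subset N → Subset N
    image = preimage from

    to-injective : ∀ {x y} → to x ≡ to y → x ≡ y
    to-injective {x} {y} e = trans (sym (from-to x)) (trans (cong from e) (from-to y))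

    to-0# : to 0# ≡ 0#
    to-0# = +-identityʳ-unique (to 0#) (to 0#) (trans (sym (to-+ 0# 0#)) (cong to (+-identityʳ 0#)))

    from-+ : ∀ x y → from (x + y) ≡ from x + from y
    from-+ x y = to-injective (trans (to-from (x + y)) (sym (trans (to-+ _ _) (cong₂ _+_ (to-from x) (to-from y)))))

    from-0# : from 0# ≡ 0#
    from-0# = trans (cong from (sym to-0#)) (from-to 0#)

    from-scale : ∀ {c} x → InFq c → from (c * x) ≡ c * from x
    from-scale {c} x c∈ = to-injective (trans (to-from (c * x)) (sym (trans (to-scale (from x) c∈) (cong (c *_) (to-from x)))))

    to-sumF : ∀ {k} (f : Fin k → Fin N) → to (sumF f) ≡ sumF (λ i → to (f i))
    to-sumF = sumF-homo to to-0# to-+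

    from-sumF : ∀ {k} (f : Fin k → Fin N) → from (sumF f) ≡ sumF (λ i → from (f i))
    from-sumF = sumF-homo from from-0# from-+

    ∈-image⁺ : ∀ {W x} → x ∈ W → to x ∈ image W
    ∈-image⁺ {W} {x} x∈W = ∈-preimage⁺ from W (subst (_∈ W) (sym (from-to x)) x∈W)

    ∈-image⁻ : ∀ {W y} → y ∈ image W → from y ∈ W
    ∈-image⁻ {W} = ∈-preimage⁻ from W

    IsSubspace-image : ∀ {W} → IsSubspace W → IsSubspace (image W)
    IsSubspace-image {W} (0∈ , +∈ , scale∈) =
      ∈-preimage⁺ from W (subst (_∈ W) (sym from-0#) 0∈) ,
      (λ x y x∈ y∈ → ∈-preimage⁺ from W (subst (_∈ W) (sym (from-+ x y)) (+∈ _ _ (∈-image⁻ x∈) (∈-image⁻ y∈)))) ,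
      (λ c x c∈ x∈ → ∈-preimage⁺ from W (subst (_∈ W) (sym (from-scale x c∈)) (scale∈ c _ c∈ (∈-image⁻ x∈))))

    HasDim-image : ∀ {m W} → HasDim m W → HasDim m (image W)
    HasDim-image {m} {W} (e , e∈ , independent , spanning) =
      (λ i → to (e i)) , (λ i → ∈-image⁺ (e∈ i)) ,
      (λ c c∈ Σ≡0 → independent c c∈ (begin
          sumF (λ i → c i * e i)          ≡⟨ sumF-cong (λ i → sym (trans (from-scale _ (c∈ i)) (cong (c i *_) (from-to (e i))))) ⟩
          sumF (λ i → from (c i * to (e i))) ≡⟨ sym (from-sumF {m} _) ⟩
          from (sumF (λ i → c i * to (e i))) ≡⟨ cong from Σ≡0 ⟩
          from 0#                         ≡⟨ from-0# ⟩
          0#                              ∎)) ,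
      (λ x x∈ → let (c , c∈ , Σ≡) = spanning (from x) (∈-image⁻ x∈) in
          c , c∈ , (begin
          sumF (λ i → c i * to (e i))     ≡⟨ sumF-cong (λ i → sym (to-scale (e i) (c∈ i))) ⟩
          sumF (λ i → to (c i * e i))     ≡⟨ sym (to-sumF {m} _) ⟩
          to (sumF (λ i → c i * e i))     ≡⟨ cong to Σ≡ ⟩
          to (from x)                     ≡⟨ to-from x ⟩
          x                               ∎))

  automorphism⇒linear : ∀ φ → FixesFq φ → FqLinearEquiv
  automorphism⇒linear φ φ-fix = record
    { to = to ; from = from ; from-to = from-to ; to-from = to-from ; to-+ = to-+
    ; to-scale = λ x c∈ → trans (to-* _ x) (cong (_* to x) (φ-fix c∈)) }
    where open Automorphism φ

  multiplication : ∀ {u u⁻¹} → u * u⁻¹ ≡ 1# → FqLinearEquiv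
  multiplication {u} {u⁻¹} uu⁻¹≡1 = record
    { to = u *_ ; from = u⁻¹ *_
    ; from-to = λ x → *-cancel-inverse x uu⁻¹≡1
    ; to-from = λ x → *-cancel-inverse x (trans (*-comm u⁻¹ u) uu⁻¹≡1)
    ; to-+ = distribˡ u
    ; to-scale = λ {c} x _ → solve 3 (λ u c x → u :* (c :* x) := c :* (u :* x)) refl u c x }
    where open Solver

  identity : FqLinearEquiv
  identity = record
    { to = λ x → x ; from = λ x → x ; from-to = λ _ → refl ; to-from = λ _ → refl
    ; to-+ = λ _ _ → refl ; to-scale = λ _ _ → refl }

  IsDirectSumDecomp-transport : ∀ {n γ δ W W′} (T : FqLinearEquiv) (π : Permutation n n) →
    (∀ i {u} → InScaled γ (toℕ (π ⟨$⟩ʳ i)) W u → InScaled δ (toℕ i) W′ (FqLinearEquiv.to T u)) →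
    (∀ i {v} → InScaled δ (toℕ i) W′ v → InScaled γ (toℕ (π ⟨$⟩ʳ i)) W (FqLinearEquiv.from T v)) →
    IsDirectSumDecomp n γ W → IsDirectSumDecomp n δ W′
  IsDirectSumDecomp-transport {n} {γ} {δ} {W} {W′} T π forward backward (exists , unique) = exists′ , unique′
    where
    open FqLinearEquiv T
    exists′ : ∀ x → Σ (Fin n → Fin N) λ u → (∀ i → InScaled δ (toℕ i) W′ (u i)) × sumF u ≡ x
    exists′ x = let (u , u∈ , Σu≡x) = exists (from x) in
      (λ i → to (u (π ⟨$⟩ʳ i))) , (λ i → forward i (u∈ (π ⟨$⟩ʳ i))) , (begin
        sumF (λ i → to (u (π ⟨$⟩ʳ i)))  ≡⟨ sym (to-sumF {n} _) ⟩
        to (sumF (λ i → u (π ⟨$⟩ʳ i)))  ≡⟨ cong to (trans (sumF-permute u π) Σu≡x) ⟩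
        to (from x)                     ≡⟨ to-from x ⟩
        x                               ∎)
    pull : (Fin n → Fin N) → Fin n → Fin N
    pull u j = from (u (π ⟨$⟩ˡ j))
    pull∈ : ∀ {u} → (∀ i → InScaled δ (toℕ i) W′ (u i)) → ∀ j → InScaled γ (toℕ j) W (pull u j)
    pull∈ {u} u∈ j = subst (λ k → InScaled γ (toℕ k) W (pull u j)) (inverseʳ π) (backward _ (u∈ (π ⟨$⟩ˡ j)))
    sumF-pull : ∀ u → sumF (pull u) ≡ from (sumF u)
    sumF-pull u = trans (sym (from-sumF {n} _)) (cong from (sumF-permute u (Perm.flip π)))
    unique′ : ∀ (u v : Fin n → Fin N) → (∀ i → InScaled δ (toℕ i) W′ (u i)) → (∀ i → InScaled δ (toℕ i) W′ (v i)) →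
              sumF u ≡ sumF v → ∀ i → u i ≡ v i
    unique′ u v u∈ v∈ Σu≡Σv i = begin
      u i                            ≡⟨ sym (to-from (u i)) ⟩
      to (from (u i))                ≡⟨ cong (λ j → to (from (u j))) (sym (inverseˡ π)) ⟩
      to (pull u (π ⟨$⟩ʳ i))         ≡⟨ cong to (unique (pull u) (pull v) (pull∈ u∈) (pull∈ v∈)
                                           (trans (sumF-pull u) (trans (cong from Σu≡Σv) (sym (sumF-pull v)))) (π ⟨$⟩ʳ i)) ⟩
      to (pull v (π ⟨$⟩ʳ i))         ≡⟨ cong (λ j → to (from (v j))) (inverseˡ π) ⟩
      to (from (v i))                ≡⟨ to-from (v i) ⟩
      v i                            ∎

  InScaled-automorphism : ∀ ψ {γ δ i W W′ u} → Automorphism.to ψ γ ≡ δ →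
    (∀ {w} → w ∈ W → Automorphism.to ψ w ∈ W′) → InScaled γ i W u → InScaled δ i W′ (Automorphism.to ψ u)
  InScaled-automorphism ψ {γ} {i = i} refl ψW⊆W′ (w , w∈ , u≡) =
    to w , ψW⊆W′ w∈ , trans (cong to u≡) (trans (to-* _ w) (cong (_* to w) (to-pow γ i)))
    where open Automorphism ψ

  InScaled-scale⁺ : ∀ {W a a⁻¹ γ} i {u} → IsSubspace W → InFq a⁻¹ → a * a⁻¹ ≡ 1# →
                    InScaled γ i W u → InScaled (a * γ) i W u
  InScaled-scale⁺ {W} {a} {a⁻¹} {γ} i (_ , _ , scale∈) a⁻¹∈ aa⁻¹≡1 (w , w∈ , u≡) =
    pow a⁻¹ i * w , scale∈ _ _ (Fq-pow i a⁻¹∈) w∈ , (begin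
      _                                        ≡⟨ u≡ ⟩
      pow γ i * w                              ≡⟨ sym (*-identityˡ _) ⟩
      1# * (pow γ i * w)                       ≡⟨ cong (_* (pow γ i * w)) (sym (pow-inverse i aa⁻¹≡1)) ⟩
      (pow a i * pow a⁻¹ i) * (pow γ i * w)
        ≡⟨ solve 4 (λ x y z w → (x :* y) :* (z :* w) := (x :* z) :* (y :* w)) refl (pow a i) (pow a⁻¹ i) (pow γ i) w ⟩
      (pow a i * pow γ i) * (pow a⁻¹ i * w)    ≡⟨ cong (_* (pow a⁻¹ i * w)) (sym (pow-distrib-* a γ i)) ⟩
      pow (a * γ) i * (pow a⁻¹ i * w)          ∎)
    where open Solver

  InScaled-scale⁻ : ∀ {W a γ} i {u} → IsSubspace W → InFq a → InScaled (a * γ) i W u → InScaled γ i W u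
  InScaled-scale⁻ {W} {a} {γ} i (_ , _ , scale∈) a∈ (w , w∈ , u≡) =
    pow a i * w , scale∈ _ _ (Fq-pow i a∈) w∈ ,
    trans u≡ (trans (cong (_* w) (trans (pow-distrib-* a γ i) (*-comm _ _))) (*-assoc _ _ _))

  -- Slot j of the γ-decomposition of W is slot i of the γ⁻¹-decomposition of γᵈ W when i + j = d.
  InScaled-reflect⁺ : ∀ {W γ γ′ d} i j {u} → γ * γ′ ≡ 1# → i ℕ.+ j ≡ d →
                      InScaled γ j W u → InScaled γ′ i (preimage (pow γ′ d *_) W) u
  InScaled-reflect⁺ {W} {γ} {γ′} {d} i j γγ′≡1 i+j≡d (w , w∈ , u≡) =
    pow γ d * w , ∈-preimage⁺ (pow γ′ d *_) W (subst (_∈ W) (sym (*-cancel-inverse w (pow-inverse d γγ′≡1))) w∈) , (begin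
      _                                          ≡⟨ u≡ ⟩
      pow γ j * w                                ≡⟨ sym (*-cancel-inverse _ (pow-inverse i γγ′≡1)) ⟩
      pow γ′ i * (pow γ i * (pow γ j * w))       ≡⟨ cong (pow γ′ i *_) (sym (*-assoc _ _ _)) ⟩
      pow γ′ i * ((pow γ i * pow γ j) * w)       ≡⟨ cong (λ z → pow γ′ i * (z * w)) (sym (pow-+ γ i j)) ⟩
      pow γ′ i * (pow γ (i ℕ.+ j) * w)           ≡⟨ cong (λ k → pow γ′ i * (pow γ k * w)) i+j≡d ⟩
      pow γ′ i * (pow γ d * w)                   ∎)

  InScaled-reflect⁻ : ∀ {W γ γ′ d} i j {u} → γ * γ′ ≡ 1# → i ℕ.+ j ≡ d →
                      InScaled γ′ i (preimage (pow γ′ d *_) W) u → InScaled γ j W u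
  InScaled-reflect⁻ {W} {γ} {γ′} {d} i j γγ′≡1 i+j≡d (w , w∈ , u≡) =
    pow γ′ d * w , ∈-preimage⁻ (pow γ′ d *_) W w∈ , (begin
      _                                          ≡⟨ u≡ ⟩
      pow γ′ i * w                               ≡⟨ sym (*-cancel-inverse _ (trans (*-comm _ _) (pow-inverse j γγ′≡1))) ⟩
      pow γ j * (pow γ′ j * (pow γ′ i * w))      ≡⟨ cong (pow γ j *_) (sym (*-assoc _ _ _)) ⟩
      pow γ j * ((pow γ′ j * pow γ′ i) * w)      ≡⟨ cong (λ z → pow γ j * (z * w)) (sym (pow-+ γ′ j i)) ⟩
      pow γ j * (pow γ′ (j ℕ.+ i) * w)           ≡⟨ cong (λ k → pow γ j * (pow γ′ k * w)) (trans (ℕ.+-comm j i) i+j≡d) ⟩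
      pow γ j * (pow γ′ d * w)                   ∎)

  powerSum : Fin N → ∀ {k} → (Fin k → Fin N) → Fin N
  powerSum γ w = sumF (λ i → pow γ (toℕ i) * w i)

  powerSum-suc : ∀ γ {k} (w : Fin (suc k) → Fin N) → powerSum γ w ≡ w zero + γ * powerSum γ (λ i → w (suc i))
  powerSum-suc γ {k} w = cong₂ _+_ (*-identityˡ (w zero))
    (trans (sumF-cong {k} (λ i → *-assoc γ _ _)) (sym (sumF-*ˡ γ (λ i → pow γ (toℕ i) * w (suc i)))))

  -- Coefficients of the Horner rewriting  c + (b + γ) (v₀ + v₁ γ + …) = t₀ + t₁ γ + … .
  hornerShift : Fin N → Fin N → ∀ {k} → (Fin k → Fin N) → Fin (suc k) → Fin N
  hornerShift b c {zero}  v zero    = c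
  hornerShift b c {suc k} v zero    = c + b * v zero
  hornerShift b c {suc k} v (suc i) = hornerShift b (v zero) (λ j → v (suc j)) i

  powerSum-hornerShift : ∀ b γ c {k} (v : Fin k → Fin N) → c + (b + γ) * powerSum γ v ≡ powerSum γ (hornerShift b c v)
  powerSum-hornerShift b γ c {zero}  v = trans (cong (c +_) (zeroʳ _)) (sym (cong (_+ 0#) (*-identityˡ c)))
  powerSum-hornerShift b γ c {suc k} v = begin
    c + (b + γ) * powerSum γ v                       ≡⟨ cong (λ z → c + (b + γ) * z) (powerSum-suc γ v) ⟩
    c + (b + γ) * (v zero + γ * X)
      ≡⟨ solve 5 (λ c b γ v₀ X → c :+ (b :+ γ) :* (v₀ :+ γ :* X) := (c :+ b :* v₀) :+ γ :* (v₀ :+ (b :+ γ) :* X)) refl c b γ (v zero) X ⟩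
    (c + b * v zero) + γ * (v zero + (b + γ) * X)    ≡⟨ cong (λ z → (c + b * v zero) + γ * z) (powerSum-hornerShift b γ (v zero) (λ j → v (suc j))) ⟩
    (c + b * v zero) + γ * powerSum γ (λ i → hornerShift b c v (suc i))
                                                     ≡⟨ sym (powerSum-suc γ (hornerShift b c v)) ⟩
    powerSum γ (hornerShift b c v)                   ∎
    where
    open Solver
    X = powerSum γ (λ j → v (suc j))

  hornerShift-zero : ∀ b c {k} (v : Fin k → Fin N) → (∀ i → hornerShift b c v i ≡ 0#) → c ≡ 0# × (∀ i → v i ≡ 0#)
  hornerShift-zero b c {zero}  v t≡0 = t≡0 zero , λ ()
  hornerShift-zero b c {suc k} v t≡0 with hornerShift-zero b (v zero) (λ j → v (suc j)) (λ i → t≡0 (suc i))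
  ... | v₀≡0 , v′≡0 =
    trans (sym (+-identityʳ c)) (trans (cong (c +_) (sym (trans (cong (b *_) v₀≡0) (zeroʳ b)))) (t≡0 zero)) ,
    λ { zero → v₀≡0 ; (suc i) → v′≡0 i }

  hornerShift-∈ : ∀ {W b} → IsSubspace W → InFq b → ∀ {c k} {v : Fin k → Fin N} → c ∈ W → (∀ i → v i ∈ W) →
                  ∀ i → hornerShift b c v i ∈ W
  hornerShift-∈ W-sub b∈ {k = zero}  c∈ v∈ zero = c∈
  hornerShift-∈ (_ , +∈ , scale∈) b∈ {k = suc k} c∈ v∈ zero = +∈ _ _ c∈ (scale∈ _ _ b∈ (v∈ zero))
  hornerShift-∈ W-sub b∈ {k = suc k} c∈ v∈ (suc i) = hornerShift-∈ W-sub b∈ (v∈ zero) (λ j → v∈ (suc j)) i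

  -- Re-expanding a power sum in γ′ = γ + b as a power sum in γ, by a unitriangular change of coefficients.
  powerSum-translate : ∀ {W γ γ′ b} → IsSubspace W → InFq b → γ′ ≡ γ + b →
    ∀ {k} (w : Fin k → Fin N) → (∀ i → w i ∈ W) →
    Σ (Fin k → Fin N) λ t → (∀ i → t i ∈ W) × powerSum γ′ w ≡ powerSum γ t × ((∀ i → t i ≡ 0#) → ∀ i → w i ≡ 0#)
  powerSum-translate W-sub b∈ γ′≡ {zero} w w∈ = w , w∈ , refl , (λ t≡0 → t≡0)
  powerSum-translate {γ = γ} {γ′} {b} W-sub b∈ γ′≡ {suc k} w w∈
    with powerSum-translate W-sub b∈ γ′≡ (λ i → w (suc i)) (λ i → w∈ (suc i))
  ... | v , v∈ , Σv≡ , v≡0⇒ =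
    hornerShift b (w zero) v , hornerShift-∈ W-sub b∈ (w∈ zero) v∈ , (begin
      powerSum γ′ w                                      ≡⟨ powerSum-suc γ′ w ⟩
      w zero + γ′ * powerSum γ′ (λ i → w (suc i))        ≡⟨ cong₂ (λ a c → w zero + a * c) (trans γ′≡ (+-comm γ b)) Σv≡ ⟩
      w zero + (b + γ) * powerSum γ v                    ≡⟨ powerSum-hornerShift b γ (w zero) v ⟩
      powerSum γ (hornerShift b (w zero) v)              ∎) ,
    λ t≡0 → let (w₀≡0 , v≡0) = hornerShift-zero b (w zero) v t≡0 in λ { zero → w₀≡0 ; (suc i) → v≡0⇒ v≡0 i }

  module _ (n : ℕ) (γ : Fin N) (W : Subset N) where

    Spans : Set
    Spans = ∀ x → Σ (Fin n → Fin N) λ w → (∀ i → w i ∈ W) × powerSum γ w ≡ x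

    Independent : Set
    Independent = ∀ (w : Fin n → Fin N) → (∀ i → w i ∈ W) → powerSum γ w ≡ 0# → ∀ i → w i ≡ 0#

  IsDirectSumDecomp⇒spans : ∀ {n γ W} → IsDirectSumDecomp n γ W → Spans n γ W
  IsDirectSumDecomp⇒spans (exists , _) x = let (u , u∈ , Σu≡x) = exists x in
    (λ i → proj₁ (u∈ i)) , (λ i → proj₁ (proj₂ (u∈ i))) , trans (sym (sumF-cong (λ i → proj₂ (proj₂ (u∈ i))))) Σu≡x

  IsDirectSumDecomp⇒independent : ∀ {n γ W} → γ ≢ 0# → IsSubspace W → IsDirectSumDecomp n γ W → Independent n γ W
  IsDirectSumDecomp⇒independent {n} {γ} γ≢0 (0∈ , _) (_ , unique) w w∈ Σ≡0 i
    with *≡0 (pow γ (toℕ i)) (w i) (unique _ (λ _ → 0#) (λ j → w j , w∈ j , refl) (λ _ → 0# , 0∈ , sym (zeroʳ _))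
                                      (trans Σ≡0 (sym (sumF-0# n))) i)
  ... | inj₁ γⁱ≡0 = ⊥-elim (pow≢0 (toℕ i) γ≢0 γⁱ≡0)
  ... | inj₂ wᵢ≡0 = wᵢ≡0

  IsDirectSumDecomp-intro : ∀ {n γ W} → IsSubspace W → Spans n γ W → Independent n γ W → IsDirectSumDecomp n γ W
  IsDirectSumDecomp-intro {n} {γ} {W} (_ , +∈ , scale∈) spans independent = exists , unique
    where
    exists : ∀ x → Σ (Fin n → Fin N) λ u → (∀ i → InScaled γ (toℕ i) W (u i)) × sumF u ≡ x
    exists x = let (w , w∈ , Σ≡x) = spans x in (λ i → pow γ (toℕ i) * w i) , (λ i → w i , w∈ i , refl) , Σ≡x
    unique : ∀ (u v : Fin n → Fin N) → (∀ i → InScaled γ (toℕ i) W (u i)) → (∀ i → InScaled γ (toℕ i) W (v i)) →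
             sumF u ≡ sumF v → ∀ i → u i ≡ v i
    unique u v u∈ v∈ Σu≡Σv i = trans (proj₂ (proj₂ (u∈ i)))
      (trans (cong (pow γ (toℕ i) *_) (x∙y⁻¹≈ε⇒x≈y _ _ (trans (cong (wᵤ i +_) (sym (-1*x≈-x _))) (d≡0 i))))
             (sym (proj₂ (proj₂ (v∈ i)))))
      where
      wᵤ wᵥ d : Fin n → Fin N
      wᵤ i = proj₁ (u∈ i)
      wᵥ i = proj₁ (v∈ i)
      d i = wᵤ i + - 1# * wᵥ i
      powerSum-d : powerSum γ d ≡ 0#
      powerSum-d = begin
        powerSum γ d                                              ≡⟨ sumF-cong (λ i → trans (distribˡ _ _ _) (cong (pow γ (toℕ i) * wᵤ i +_)
                                                                        (solve 3 (λ a b c → a :* (b :* c) := b :* (a :* c)) refl _ _ _))) ⟩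
        sumF (λ i → pow γ (toℕ i) * wᵤ i + - 1# * (pow γ (toℕ i) * wᵥ i))
                                                                  ≡⟨ sumF-+ {n} _ _ ⟩
        powerSum γ wᵤ + sumF (λ i → - 1# * (pow γ (toℕ i) * wᵥ i)) ≡⟨ cong (powerSum γ wᵤ +_) (sym (sumF-*ˡ {n} (- 1#) _)) ⟩
        powerSum γ wᵤ + - 1# * powerSum γ wᵥ                      ≡⟨ cong₂ (λ a c → a + - 1# * c) (sym (sumF-cong (λ i → proj₂ (proj₂ (u∈ i)))))
                                                                                                (sym (sumF-cong (λ i → proj₂ (proj₂ (v∈ i))))) ⟩
        sumF u + - 1# * sumF v                                    ≡⟨ cong₂ _+_ Σu≡Σv (-1*x≈-x _) ⟩
        sumF v + - sumF v                                         ≡⟨ -‿inverseʳ _ ⟩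
        0#                                                        ∎
        where open Solver
      d≡0 : ∀ i → d i ≡ 0#
      d≡0 = independent d (λ i → +∈ _ _ (proj₁ (proj₂ (u∈ i))) (scale∈ _ _ (Fq-neg Fq-1#) (proj₁ (proj₂ (v∈ i))))) powerSum-d

  IsDirectSumDecomp-translate : ∀ {n γ γ′ b W} → InFq b → γ ≢ 0# → γ′ ≡ γ + b → IsSubspace W →
                                IsDirectSumDecomp n γ W → IsDirectSumDecomp n γ′ W
  IsDirectSumDecomp-translate {n} {γ} {γ′} {b} {W} b∈ γ≢0 γ′≡γ+b W-sub W-sum =
    IsDirectSumDecomp-intro W-sub spans′ independent′
    where
    γ≡γ′-b : γ ≡ γ′ + - b
    γ≡γ′-b = sym (trans (cong (_+ - b) γ′≡γ+b) (trans (+-assoc _ _ _) (trans (cong (γ +_) (-‿inverseʳ b)) (+-identityʳ γ))))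
    spans′ : Spans n γ′ W
    spans′ x = let (w , w∈ , Σ≡x) = IsDirectSumDecomp⇒spans W-sum x
                   (t , t∈ , Σw≡Σt , _) = powerSum-translate W-sub (Fq-neg b∈) γ≡γ′-b w w∈
               in t , t∈ , trans (sym Σw≡Σt) Σ≡x
    independent′ : Independent n γ′ W
    independent′ w w∈ Σ≡0 = let (t , t∈ , Σw≡Σt , t≡0⇒w≡0) = powerSum-translate W-sub b∈ γ′≡γ+b w w∈ in
      t≡0⇒w≡0 (IsDirectSumDecomp⇒independent γ≢0 W-sub W-sum t t∈ (trans (sym Σw≡Σt) Σ≡0))

  module Counting (m n : ℕ) where

    -- γ ∼ δ says S(γ,m,n;q) = S(δ,m,n;q).
    _∼_ : Fin N → Fin N → Set
    γ ∼ δ = ∀ k → (SplittingCount F q m n γ k → SplittingCount F q m n δ k)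
                × (SplittingCount F q m n δ k → SplittingCount F q m n γ k)

    ∼-trans : ∀ {γ δ ε} → γ ∼ δ → δ ∼ ε → γ ∼ ε
    ∼-trans γ∼δ δ∼ε k = (λ c → proj₁ (δ∼ε k) (proj₁ (γ∼δ k) c)) , (λ c → proj₂ (γ∼δ k) (proj₂ (δ∼ε k) c))

    ∼-intro : ∀ {γ δ} (g h : Subset N → Subset N) → (∀ W → g (h W) ≡ W) → (∀ W → h (g W) ≡ W) →
              (∀ W → IsSplitting m n γ W → IsSplitting m n δ (g W)) →
              (∀ W → IsSplitting m n δ W → IsSplitting m n γ (h W)) → γ ∼ δ
    ∼-intro g h g∘h h∘g forward backward k =
      HasCount-bijection g h g∘h h∘g forward backward , HasCount-bijection h g h∘g g∘h backward forward

    ∼-of-directSum : ∀ {γ δ} →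
      (∀ {W} → IsSubspace W → IsDirectSumDecomp n γ W → IsDirectSumDecomp n δ W) →
      (∀ {W} → IsSubspace W → IsDirectSumDecomp n δ W → IsDirectSumDecomp n γ W) → γ ∼ δ
    ∼-of-directSum forward backward = ∼-intro (λ W → W) (λ W → W) (λ _ → refl) (λ _ → refl)
      (λ W (W-sub , W-dim , W-sum) → W-sub , W-dim , forward W-sub W-sum)
      (λ W (W-sub , W-dim , W-sum) → W-sub , W-dim , backward W-sub W-sum)

    IsSplitting-image : ∀ {γ δ W} (L T : FqLinearEquiv) (π : Permutation n n) →
      (∀ i {u} → InScaled γ (toℕ (π ⟨$⟩ʳ i)) W u → InScaled δ (toℕ i) (FqLinearEquiv.image L W) (FqLinearEquiv.to T u)) →
      (∀ i {v} → InScaled δ (toℕ i) (FqLinearEquiv.image L W) v → InScaled γ (toℕ (π ⟨$⟩ʳ i)) W (FqLinearEquiv.from T v)) →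
      IsSplitting m n γ W → IsSplitting m n δ (FqLinearEquiv.image L W)
    IsSplitting-image L T π forward backward (W-sub , W-dim , W-sum) =
      IsSubspace-image W-sub , HasDim-image W-dim , IsDirectSumDecomp-transport T π forward backward W-sum
      where open FqLinearEquiv L using (IsSubspace-image; HasDim-image)

    ∼-automorphism : ∀ φ → FixesFq φ → ∀ γ → γ ∼ Automorphism.to φ γ
    ∼-automorphism φ φ-fix γ =
      ∼-intro (preimage from) (preimage to) (preimage-inverse from to to-from) (preimage-inverse to from from-to)
        (λ W → IsSplitting-image L L Perm.id
                 (λ i → InScaled-automorphism φ {i = toℕ i} refl (∈-preimage⁺ from W ∘ subst (_∈ W) (sym (from-to _))))
                 (λ i → InScaled-automorphism φ⁻¹ {i = toℕ i} (from-to γ) (∈-preimage⁻ from W)))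
        (λ W → IsSplitting-image L⁻¹ L⁻¹ Perm.id
                 (λ i → InScaled-automorphism φ⁻¹ {i = toℕ i} (from-to γ) (∈-preimage⁺ to W ∘ subst (_∈ W) (sym (to-from _))))
                 (λ i → InScaled-automorphism φ {i = toℕ i} refl (∈-preimage⁻ to W)))
      where
      open Automorphism φ
      φ⁻¹ : Automorphism
      φ⁻¹ = inverse-automorphism
      L L⁻¹ : FqLinearEquiv
      L = automorphism⇒linear φ φ-fix
      L⁻¹ = automorphism⇒linear φ⁻¹ (inverse-fixesFq φ φ-fix)

    ∼-scale : ∀ {a} → InFq a → a ≢ 0# → ∀ γ → γ ∼ (a * γ)
    ∼-scale {a} a∈ a≢0 γ with inverse a a≢0
    ... | a⁻¹ , aa⁻¹≡1 = ∼-of-directSum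
      (λ W-sub → IsDirectSumDecomp-transport identity Perm.id
                   (λ i → InScaled-scale⁺ (toℕ i) W-sub a⁻¹∈ aa⁻¹≡1) (λ i → InScaled-scale⁻ (toℕ i) W-sub a∈))
      (λ W-sub → IsDirectSumDecomp-transport identity Perm.id
                   (λ i → InScaled-scale⁻ (toℕ i) W-sub a∈) (λ i → InScaled-scale⁺ (toℕ i) W-sub a⁻¹∈ aa⁻¹≡1))
      where a⁻¹∈ = Fq-inverse a∈ aa⁻¹≡1

    IsSplitting-inverse : ∀ {γ γ′ W} (γγ′≡1 : γ * γ′ ≡ 1#) → IsSplitting m n γ W →
      IsSplitting m n γ′ (preimage (pow γ′ (n ∸ 1) *_) W)
    IsSplitting-inverse γγ′≡1 = IsSplitting-image (multiplication (pow-inverse (n ∸ 1) γγ′≡1)) identity Perm.reverse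
      (λ i → InScaled-reflect⁺ (toℕ i) _ γγ′≡1 (i+opposite i)) (λ i → InScaled-reflect⁻ (toℕ i) _ γγ′≡1 (i+opposite i))
      where
      i+opposite : ∀ {n} (i : Fin n) → toℕ i ℕ.+ toℕ (Fin.opposite i) ≡ n ∸ 1
      i+opposite {suc n} i = trans (cong (toℕ i ℕ.+_) (Fin.opposite-prop i)) (ℕ.m+[n∸m]≡n (ℕ.≤-pred (Fin.toℕ<n i)))

    ∼-inverse : ∀ {γ γ′} → γ * γ′ ≡ 1# → γ ∼ γ′
    ∼-inverse {γ} {γ′} γγ′≡1 = ∼-intro (preimage (pow γ′ (n ∸ 1) *_)) (preimage (pow γ (n ∸ 1) *_))
      (preimage-inverse _ _ (λ x → *-cancel-inverse x (trans (*-comm _ _) (pow-inverse (n ∸ 1) γγ′≡1))))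
      (preimage-inverse _ _ (λ x → *-cancel-inverse x (pow-inverse (n ∸ 1) γγ′≡1)))
      (λ W → IsSplitting-inverse γγ′≡1) (λ W → IsSplitting-inverse (trans (*-comm γ′ γ) γγ′≡1))

    ∼-translate : ∀ {b} → InFq b → ∀ {γ} → ¬ InFq γ → γ ∼ (γ + b)
    ∼-translate {b} b∈ {γ} γ∉ = ∼-of-directSum
      (IsDirectSumDecomp-translate b∈ (∉Fq⇒≢0 γ∉) refl)
      (IsDirectSumDecomp-translate (Fq-neg b∈) (∉Fq⇒≢0 (∉Fq-+ʳ b∈ γ∉)) (sym γ+b-b≡γ))
      where
      γ+b-b≡γ : γ + b + - b ≡ γ
      γ+b-b≡γ = trans (+-assoc γ b (- b)) (trans (cong (γ +_) (-‿inverseʳ b)) (+-identityʳ γ))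

    ∼-affine : ∀ {A B} → InFq A → A ≢ 0# → InFq B → ∀ {γ} → ¬ InFq γ → γ ∼ (A * γ + B)
    ∼-affine A∈ A≢0 B∈ {γ} γ∉ = ∼-trans (∼-scale A∈ A≢0 γ) (∼-translate B∈ (∉Fq-*ˡ A∈ A≢0 γ∉))

    ∼-mobius : ∀ {a b c d γ β} → InFq a → InFq b → InFq c → InFq d → ¬ InFq γ → ¬ InFq β →
               c * γ + d ≢ 0# → β * (c * γ + d) ≡ a * γ + b → γ ∼ β
    ∼-mobius {a} {b} {c} {d} {γ} {β} a∈ b∈ c∈ d∈ γ∉ β∉ cγ+d≢0 β≡ with c ≟ 0#
    ... | yes refl with inverse d (cγ+d≢0 ∘ trans (trans (cong (_+ d) (zeroˡ γ)) (+-identityˡ d)))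
    ...   | d⁻¹ , dd⁻¹≡1 = subst (γ ∼_) (sym β≡′) (∼-affine A∈ (affine-coefficient≢0 B∈ β∉ β≡′) B∈ γ∉)
      where
      d⁻¹∈ : InFq d⁻¹
      d⁻¹∈ = Fq-inverse d∈ dd⁻¹≡1
      A∈ : InFq (a * d⁻¹)
      A∈ = Fq-* a∈ d⁻¹∈
      B∈ : InFq (b * d⁻¹)
      B∈ = Fq-* b∈ d⁻¹∈
      β≡′ : β ≡ (a * d⁻¹) * γ + b * d⁻¹
      β≡′ = mobius-c≡0 dd⁻¹≡1 β≡
    ∼-mobius {a} {b} {c} {d} {γ} {β} a∈ b∈ c∈ d∈ γ∉ β∉ cγ+d≢0 β≡ | no c≢0
      with inverse c c≢0 | inverse (c * γ + d) cγ+d≢0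
    ... | c⁻¹ , cc⁻¹≡1 | δ , [cγ+d]δ≡1 =
      ∼-trans (∼-affine c∈ c≢0 d∈ γ∉) (∼-trans (∼-inverse [cγ+d]δ≡1)
        (subst (δ ∼_) (sym β≡′) (∼-affine E∈ (affine-coefficient≢0 C∈ β∉ β≡′) C∈ δ∉)))
      where
      c⁻¹∈ : InFq c⁻¹
      c⁻¹∈ = Fq-inverse c∈ cc⁻¹≡1
      C∈ : InFq (a * c⁻¹)
      C∈ = Fq-* a∈ c⁻¹∈
      E∈ : InFq (b + - (a * c⁻¹ * d))
      E∈ = Fq-+ b∈ (Fq-neg (Fq-* C∈ d∈))
      δ∉ : ¬ InFq δ
      δ∉ = ∉Fq-inverse [cγ+d]δ≡1 (∉Fq-+ʳ d∈ (∉Fq-*ˡ c∈ c≢0 γ∉))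
      β≡′ : β ≡ (b + - (a * c⁻¹ * d)) * δ + a * c⁻¹
      β≡′ = mobius-c≢0 cc⁻¹≡1 [cγ+d]δ≡1 β≡

  ∼-single-summand : ∀ m γ δ → Counting._∼_ m 1 γ δ
  ∼-single-summand m γ δ = Counting.∼-of-directSum m 1
    (λ _ → IsDirectSumDecomp-transport identity Perm.id (λ { zero u∈ → u∈ }) (λ { zero u∈ → u∈ }))
    (λ _ → IsDirectSumDecomp-transport identity Perm.id (λ { zero u∈ → u∈ }) (λ { zero u∈ → u∈ }))

-- Opened only now: the field modules above use _*_ for multiplication in F.
open import Data.Nat using (_^_; _*_)
open import Defs using (Generates; InFq)

primePower≥2 : ∀ {q} → IsPrimePower q → 2 ≤ q
primePower≥2 (p , k , p-prime , 1≤k , refl) =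
  ℕ.≤-trans (ℕ.nonTrivial⇒n>1 p {{prime⇒nonTrivial p-prime}}) (subst (_≤ p ^ k) (ℕ.^-identityʳ p) (ℕ.^-monoʳ-≤ p 1≤k))
  where instance _ = prime⇒nonZero p-prime

pow-primePower-+ : ∀ {N} (F : FiniteField N) {q e} → IsPrimePower q → N ≡ q ^ e → FieldProperties.AdditivePower F q
pow-primePower-+ F {e = e} (p , k , p-prime , _ , refl) N≡ = PrimePowerOrder.pow-pʲ-+ F {e = k * e} p-prime (trans N≡ (ℕ.^-*-assoc p k e)) k

m<m^n : ∀ {m n} → 2 ≤ m → 2 ≤ n → m < m ^ n
m<m^n {m} {n} 2≤m 2≤n = subst (_< m ^ n) (ℕ.^-identityʳ m) (ℕ.^-monoʳ-< m 2≤m 2≤n)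

proposition4p3 : ∀ {N : ℕ} (F : FiniteField N) (q m n : ℕ) →
    IsPrimePower q → 1 ≤ m → 1 ≤ n → N ≡ q ^ (m * n) →
    (α : Fin N) → Generates F q α →
    (β : Fin N) (r : ℕ) (a b c d : Fin N) →
    InFq F q a → InFq F q b → InFq F q c → InFq F q d →
    FiniteField._-_ F (FiniteField._*_ F a d) (FiniteField._*_ F b c) ≢ FiniteField.0# F →
    FiniteField._+_ F (FiniteField._*_ F c (FiniteField.pow F α (q ^ r))) d ≢ FiniteField.0# F →
    FiniteField._*_ F β (FiniteField._+_ F (FiniteField._*_ F c (FiniteField.pow F α (q ^ r))) d)
      ≡ FiniteField._+_ F (FiniteField._*_ F a (FiniteField.pow F α (q ^ r))) b →
    Generates F q β ×
    (∀ k → (SplittingCount F q m n α k → SplittingCount F q m n β k)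
         × (SplittingCount F q m n β k → SplittingCount F q m n α k))
proposition4p3 F q m n q-pp 1≤m 1≤n N≡qᵐⁿ α α-gen β r a b c d a∈ b∈ c∈ d∈ det≢0 cγ+d≢0 β≡ =
  β-gen , α∼β
  where
  pow-q-+ : FieldProperties.AdditivePower F q
  pow-q-+ = pow-primePower-+ F {e = m * n} q-pp N≡qᵐⁿ
  open OverFq F q pow-q-+
  open SplittingSubspaces F q pow-q-+
  open Automorphisms F using (Automorphism)
  σ : Automorphism
  σ = frobenius-automorphism r
  γ-gen : Generates F q (frobenius r α)
  γ-gen = Generates-automorphism σ (frobenius-fixesFq r) α-gen
  β-gen : Generates F q β
  β-gen K K-sub Fq⊆K β∈K = γ-gen K K-sub Fq⊆K (∈-subfield-mobius K-sub Fq⊆K a∈ b∈ c∈ d∈ det≢0 β≡ β∈K)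
  α∼β : Counting._∼_ m n α β
  α∼β with ℕ.m≤n⇒m<n∨m≡n 1≤n
  ... | inj₂ refl = ∼-single-summand m α β
  ... | inj₁ 1<n = ∼-trans (∼-automorphism σ (frobenius-fixesFq r) α) (∼-mobius a∈ b∈ c∈ d∈ γ∉ β∉ cγ+d≢0 β≡)
    where
    open Counting m n
    2≤q : 2 ≤ q
    2≤q = primePower≥2 q-pp
    α∉ : ¬ InFq F q α
    α∉ = generator∉Fq 2≤q (subst (q <_) (sym N≡qᵐⁿ) (m<m^n 2≤q (ℕ.*-mono-≤ 1≤m 1<n))) α-gen
    γ∉ : ¬ InFq F q (frobenius r α)
    γ∉ γ∈ = α∉ (InFq-automorphism⁻ σ γ∈)
    β∉ : ¬ InFq F q β
    β∉ β∈ = γ∉ (∈Fq⁻ (∈-subfield-mobius Fq-isSubfield (λ _ → ∈Fq⁺) a∈ b∈ c∈ d∈ det≢0 β≡ (∈Fq⁺ β∈)))
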